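{- Let $G$ be a finite undirected graph on vertex set $\{1,\dots,n\}$ that is either a complete graph or a wheel, and let $(i,j)\in E(G)$. Then every optimal basic feasible solution $x^0$ of the linear program RELP$(i,j)$ on $G$ gives an optimal vertex cover of $G$, i.e. $x^0\in\{0,1\}^n$ and $\{k : x^0_k=1\}$ is a minimum-cardinality vertex cover of $G$.
   Context: A vertex cover of $G=(V,E)$ is a set of vertices meeting every edge. An odd cycle of $G$ is a cycle with $2s+1$ vertices for some integer $s\ge1$; let $\Omega$ be the set of all odd cycles of $G$, and for $\omega_k\in\Omega$ write $|\omega_k|=2s_k+1$. For an edge $(r,s)\in E$, RELP$(r,s)$ is the linear program: minimize $\sum_{v=1}^n x_v$ subject to $x_u+x_v\ge1$ for all $(u,v)\in E\setminus\{(r,s)\}$, $x_r+x_s=1$, $\sum_{v\in\omega_k}x_v\ge s_k+1$ for all $\omega_k\in\Omega$, and $x_v\ge0$ for all $v$. A wheel is the graph obtained from a cycle by adding one new vertex adjacent to every vertex of the cycle. -}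

module Defs where

open import Data.Nat using (ℕ; zero; suc; _*_) renaming (_≤_ to _≤ℕ_)
open import Data.Fin using (Fin; zero; suc; toℕ; fromℕ)
open import Data.Fin.Subset using (Subset; _∈_; _∉_; ∣_∣)
open import Data.Integer using (+_)
open import Data.Rational using (ℚ; 0ℚ; 1ℚ; _+_; _≤_; _/_)
open import Data.Product using (Σ; Σ-syntax; ∃; _×_)
open import Data.Sum using (_⊎_)
open import Data.Empty using (⊥)
open import Data.Unit using (⊤)
open import Relation.Nullary using (¬_)
open import Relation.Binary.PropositionalEquality using (_≡_; _≢_)
open import Function.Bundles using (_⤖_; Bijection)
open import Function.Definitions using (Injective)

-- A graph on vertex set Fin n (= {1,…,n}) is given by its adjacency relation.
Graph : ℕ → Set₁
Graph n = Fin n → Fin n → Set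

sumℚ : ∀ {m} → (Fin m → ℚ) → ℚ
sumℚ {zero}  f = 0ℚ
sumℚ {suc m} f = f zero + sumℚ (λ i → f (suc i))

ℕ→ℚ : ℕ → ℚ
ℕ→ℚ k = (+ k) / 1

IsComplete : ∀ {n} → Graph n → Set
IsComplete {n} G = ∀ (u v : Fin n) → (G u v → u ≢ v) × (u ≢ v → G u v)

RimStep : ∀ {m} → Fin m → Fin m → Set
RimStep {m} i j = (toℕ j ≡ suc (toℕ i)) ⊎ ((suc (toℕ i) ≡ m) × (toℕ j ≡ 0))

-- the standard wheel W_m on Fin (suc m): hub = zero, rim = suc i (cycle C_m)
WheelAdj : (m : ℕ) → Graph (suc m)
WheelAdj m zero    zero    = ⊥
WheelAdj m zero    (suc _) = ⊤
WheelAdj m (suc _) zero    = ⊤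
WheelAdj m (suc i) (suc j) = RimStep {m} i j ⊎ RimStep {m} j i

IsWheel : ∀ {n} → Graph n → Set
IsWheel {n} G =
  Σ[ m ∈ ℕ ] (3 ≤ℕ m) × Σ[ π ∈ Fin n ⤖ Fin (suc m) ]
    (∀ u v → (G u v → WheelAdj m (Bijection.to π u) (Bijection.to π v))
           × (WheelAdj m (Bijection.to π u) (Bijection.to π v) → G u v))

record OddCycle {n} (G : Graph n) : Set where
  field
    s      : ℕ
    s≥1    : 1 ≤ℕ s
    vert   : Fin (suc (2 * s)) → Fin n
    inj    : Injective _≡_ _≡_ vert
    step   : ∀ i j → toℕ j ≡ suc (toℕ i) → G (vert i) (vert j)
    close  : G (vert (fromℕ (2 * s))) (vert zero)

SameEdge : ∀ {n} → Fin n → Fin n → Fin n → Fin n → Set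
SameEdge u v r s = ((u ≡ r) × (v ≡ s)) ⊎ ((u ≡ s) × (v ≡ r))

record RELPFeasible {n} (G : Graph n) (r s : Fin n) (x : Fin n → ℚ) : Set where
  field
    edge   : ∀ u v → G u v → ¬ SameEdge u v r s → 1ℚ ≤ x u + x v
    eqn    : x r + x s ≡ 1ℚ
    cycle  : (ω : OddCycle G) →
             ℕ→ℚ (suc (OddCycle.s ω)) ≤ sumℚ (λ i → x (OddCycle.vert ω i))
    nonneg : ∀ v → 0ℚ ≤ x v

objective : ∀ {n} → (Fin n → ℚ) → ℚ
objective x = sumℚ x

-- Basic feasible solution: x is feasible and the coefficient vectors of the
-- constraints active (tight) at x have rank n, i.e. the only direction d
-- orthogonal to all of them is d = 0.
ActiveKernelTrivial : ∀ {n} (G : Graph n) (r s : Fin n) (x : Fin n → ℚ) → Set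
ActiveKernelTrivial {n} G r s x =
  (d : Fin n → ℚ) →
  (∀ u v → G u v → ¬ SameEdge u v r s → x u + x v ≡ 1ℚ → d u + d v ≡ 0ℚ) →
  (d r + d s ≡ 0ℚ) →
  ((ω : OddCycle G) →
     sumℚ (λ i → x (OddCycle.vert ω i)) ≡ ℕ→ℚ (suc (OddCycle.s ω)) →
     sumℚ (λ i → d (OddCycle.vert ω i)) ≡ 0ℚ) →
  (∀ v → x v ≡ 0ℚ → d v ≡ 0ℚ) →
  ∀ v → d v ≡ 0ℚ

IsBasicFeasible : ∀ {n} (G : Graph n) (r s : Fin n) (x : Fin n → ℚ) → Set
IsBasicFeasible G r s x = RELPFeasible G r s x × ActiveKernelTrivial G r s x

IsOptimal : ∀ {n} (G : Graph n) (r s : Fin n) (x : Fin n → ℚ) → Set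
IsOptimal {n} G r s x =
  RELPFeasible G r s x × (∀ (y : Fin n → ℚ) → RELPFeasible G r s y → objective x ≤ objective y)

IsVertexCover : ∀ {n} → Graph n → Subset n → Set
IsVertexCover {n} G C = ∀ u v → G u v → (u ∈ C) ⊎ (v ∈ C)

IsMinVertexCover : ∀ {n} → Graph n → Subset n → Set
IsMinVertexCover {n} G C =
  IsVertexCover G C × (∀ (D : Subset n) → IsVertexCover G D → ∣ C ∣ ≤ℕ ∣ D ∣)

module Submission where

-- Integrality comes from convexity: if a basic feasible x is a convex combination of 0/1
-- covers, every cover with positive weight is tight wherever x is, hence differs from x by a
-- vector in the kernel of the active constraints, which is trivial.  So it suffices to write x
-- as such a combination.  In K_n the triangle constraints force x k ≥ 1 = x i + x j off the
-- edge, and optimality forces equality, so x = x i (1 - e_j) + x j (1 - e_i).  In a wheel with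
-- rim of length m ≥ 4, summing the triangle and rim constraints against the optimum
-- 1 + ⌈m/2⌉ forces the hub value to be 1 and the rim sum to be ⌈m/2⌉; then the rim vector is a
-- convex combination of the two alternating covers (m even) or of the m covers with exactly one
-- pair of adjacent 1s (m odd), the latter because on an odd cycle a vector is determined by its
-- edge sums.  Finally the support of the 0/1 vector x is a minimum vertex cover, since the
-- objective at x is at most the value of an explicit 0/1 solution, which no 0/1 cover beats.

open import Defs
open import Data.Nat using (ℕ)
open import Data.Fin using (Fin)
open import Data.Fin.Subset using (Subset; _∈_; _∉_)
open import Data.Rational using (ℚ; 0ℚ; 1ℚ)
open import Data.Product using (Σ-syntax; _×_)
open import Data.Sum using (_⊎_)
open import Relation.Binary.PropositionalEquality using (_≡_)

open import Data.Bool using (Bool; true; false; not; _xor_; if_then_else_; T)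
open import Data.Bool.Properties using (not-distribˡ-xor; xor-same; T-≡)
open import Data.Empty using (⊥-elim)
open import Data.Fin as Fin using (zero; suc; toℕ; fromℕ; fromℕ<; inject₁)
import Data.Fin.Properties as Finₚ
open import Data.Fin.Induction using (<-weakInduction)
open import Data.Fin.Subset using (∣_∣)
import Data.Integer as ℤ
import Data.Integer.Properties as ℤₚ

open import Data.Nat as ℕ using (zero; suc)
import Data.Nat.Properties as ℕₚ
open import Data.Product using (∃; _,_; proj₁; proj₂) renaming (map to Σ-map)
open import Data.Rational hiding (∣_∣)
open import Data.Rational.Properties
open import Data.Rational.Unnormalised as ℚᵘ using (mkℚᵘ; *≡*)
import Data.Rational.Unnormalised.Properties as ℚᵘₚ
open import Data.Sum using (inj₁; inj₂; [_,_]′) renaming (map to ⊎-map)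
open import Data.Unit using (tt)
open import Data.Vec using (lookup; tabulate; _∷_; [])
import Data.Vec.Properties as Vecₚ
open import Data.Vec.Functional using () renaming (_∷_ to _∷ᶠ_)
open import Function using (_∘_; id; Equivalence)
open import Function.Bundles using (_⤖_; Bijection; Inverse)
open import Function.Properties.Bijection using (⤖⇒↔)
open import Relation.Binary.PropositionalEquality
open import Relation.Binary.Definitions using (tri<; tri≈; tri>)
open import Relation.Nullary using (¬_; yes; no; Dec; does; contradiction; _×-dec_; _⊎-dec_)
open import Relation.Nullary.Decidable using (dec⇒maybe; dec-true)
open import Tactic.RingSolver using (solve-∀)
open import Tactic.RingSolver.Core.AlmostCommutativeRing using (AlmostCommutativeRing; fromCommutativeRing)
import Algebra.Properties.CommutativeMonoid.Sum as MonoidSum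

-- Coefficients are compared with _≟_, so that the normaliser can cancel them.
ℚ-ring : AlmostCommutativeRing _ _
ℚ-ring = fromCommutativeRing +-*-commutativeRing (λ q → dec⇒maybe (0ℚ ≟ q))

0≤1 : 0ℚ ≤ 1ℚ
0≤1 = *≤* (ℤ.+≤+ ℕ.z≤n)

0<1 : 0ℚ < 1ℚ
0<1 = *<* (ℤ.+<+ (ℕ.s≤s ℕ.z≤n))

+-nonNeg : ∀ {p q} → 0ℚ ≤ p → 0ℚ ≤ q → 0ℚ ≤ p + q
+-nonNeg p≥0 q≥0 = +-mono-≤ p≥0 q≥0

*-nonNeg : ∀ {p q} → 0ℚ ≤ p → 0ℚ ≤ q → 0ℚ ≤ p * q
*-nonNeg {p} {q} p≥0 q≥0 = subst (_≤ p * q) (*-zeroˡ q) (*-monoʳ-≤-nonNeg q {{nonNegative q≥0}} p≥0)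

p≤q⇒0≤q-p : ∀ {p q} → p ≤ q → 0ℚ ≤ q - p
p≤q⇒0≤q-p {p} {q} h = subst (_≤ q - p) (+-inverseʳ p) (+-monoˡ-≤ (- p) h)

p<q⇒0<q-p : ∀ {p q} → p < q → 0ℚ < q - p
p<q⇒0<q-p {p} {q} h = subst (_< q - p) (+-inverseʳ p) (+-monoˡ-< (- p) h)

p+[q-p]≡q : ∀ p q → p + (q - p) ≡ q
p+[q-p]≡q = solve-∀ ℚ-ring

p+q-p≡q : ∀ p q → p + q - p ≡ q
p+q-p≡q = solve-∀ ℚ-ring

p+q≡r⇒q≡r-p : ∀ p {q r} → p + q ≡ r → q ≡ r - p
p+q≡r⇒q≡r-p p {q} refl = sym (p+q-p≡q p q)

q-p≡0⇒p≡q : ∀ {p q} → q - p ≡ 0ℚ → p ≡ q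
q-p≡0⇒p≡q {p} {q} h = begin
  p             ≡⟨ +-identityʳ p ⟨
  p + 0ℚ        ≡⟨ cong (p +_) h ⟨
  p + (q - p)   ≡⟨ p+[q-p]≡q p q ⟩
  q             ∎
  where open ≡-Reasoning

≤-by-slack : ∀ {p q} s → q - p ≡ s → 0ℚ ≤ s → p ≤ q
≤-by-slack {p} {q} s eq s≥0 =
  subst₂ _≤_ (+-identityʳ p) (p+[q-p]≡q p q) (+-monoʳ-≤ p (subst (0ℚ ≤_) (sym eq) s≥0))

p≤p+q : ∀ {p q} → 0ℚ ≤ q → p ≤ p + q
p≤p+q {p} {q} q≥0 = subst (_≤ p + q) (+-identityʳ p) (+-monoʳ-≤ p q≥0)

p≤q+p : ∀ {p q} → 0ℚ ≤ q → p ≤ q + p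
p≤q+p {p} {q} q≥0 = subst (_≤ q + p) (+-identityˡ p) (+-monoˡ-≤ p q≥0)

nonNeg+nonNeg≤0⇒0 : ∀ {p q} → 0ℚ ≤ p → 0ℚ ≤ q → p + q ≤ 0ℚ → p ≡ 0ℚ
nonNeg+nonNeg≤0⇒0 p≥0 q≥0 p+q≤0 = ≤-antisym (≤-trans (p≤p+q q≥0) p+q≤0) p≥0

½[p+p]≡p : ∀ p → ½ * (p + p) ≡ p
½[p+p]≡p = solve-∀ ℚ-ring

half-injective : ∀ {p q} → p + p ≡ q + q → p ≡ q
half-injective {p} {q} eq = begin
  p              ≡⟨ ½[p+p]≡p p ⟨
  ½ * (p + p)    ≡⟨ cong (½ *_) eq ⟩
  ½ * (q + q)    ≡⟨ ½[p+p]≡p q ⟩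
  q              ∎
  where open ≡-Reasoning

half-cancel-≤ : ∀ {p q} → p + p ≤ q + q → p ≤ q
half-cancel-≤ {p} {q} h = subst₂ _≤_ (½[p+p]≡p p) (½[p+p]≡p q) (*-monoˡ-≤-nonNeg ½ h)

ℕ→ℚ-suc : ∀ k → ℕ→ℚ (suc k) ≡ 1ℚ + ℕ→ℚ k
ℕ→ℚ-suc k = toℚᵘ-injective (begin
  toℚᵘ (ℕ→ℚ (suc k))             ≈⟨ toℚᵘ-fromℚᵘ (mkℚᵘ (ℤ.+ suc k) 0) ⟩
  mkℚᵘ (ℤ.+ suc k) 0                ≈⟨ *≡* (cong (ℤ._* ℤ.1ℤ) (cong (ℤ._+_ ℤ.1ℤ) (sym (ℤₚ.*-identityʳ (ℤ.+ k))))) ⟩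
  mkℚᵘ (ℤ.+ 1) 0 ℚᵘ.+ mkℚᵘ (ℤ.+ k) 0  ≈⟨ ℚᵘₚ.+-cong (toℚᵘ-fromℚᵘ (mkℚᵘ (ℤ.+ 1) 0)) (toℚᵘ-fromℚᵘ (mkℚᵘ (ℤ.+ k) 0)) ⟨
  toℚᵘ 1ℚ ℚᵘ.+ toℚᵘ (ℕ→ℚ k)      ≈⟨ toℚᵘ-homo-+ 1ℚ (ℕ→ℚ k) ⟨
  toℚᵘ (1ℚ + ℕ→ℚ k)              ∎)
  where open ℚᵘₚ.≃-Reasoning

ℕ→ℚ-+ : ∀ a b → ℕ→ℚ (a ℕ.+ b) ≡ ℕ→ℚ a + ℕ→ℚ b
ℕ→ℚ-+ zero    b = sym (+-identityˡ (ℕ→ℚ b))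
ℕ→ℚ-+ (suc a) b = begin
  ℕ→ℚ (suc (a ℕ.+ b))          ≡⟨ ℕ→ℚ-suc (a ℕ.+ b) ⟩
  1ℚ + ℕ→ℚ (a ℕ.+ b)           ≡⟨ cong (1ℚ +_) (ℕ→ℚ-+ a b) ⟩
  1ℚ + (ℕ→ℚ a + ℕ→ℚ b)         ≡⟨ +-assoc 1ℚ (ℕ→ℚ a) (ℕ→ℚ b) ⟨
  1ℚ + ℕ→ℚ a + ℕ→ℚ b           ≡⟨ cong (_+ ℕ→ℚ b) (ℕ→ℚ-suc a) ⟨
  ℕ→ℚ (suc a) + ℕ→ℚ b          ∎
  where open ≡-Reasoning

ℕ→ℚ-nonNeg : ∀ k → 0ℚ ≤ ℕ→ℚ k
ℕ→ℚ-nonNeg zero    = ≤-refl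
ℕ→ℚ-nonNeg (suc k) = subst (0ℚ ≤_) (sym (ℕ→ℚ-suc k)) (+-nonNeg 0≤1 (ℕ→ℚ-nonNeg k))

ℕ→ℚ-mono-≤ : ∀ {a b} → a ℕ.≤ b → ℕ→ℚ a ≤ ℕ→ℚ b
ℕ→ℚ-mono-≤ {a} a≤b with ℕₚ.m≤n⇒∃[o]m+o≡n a≤b
... | d , refl = ≤-by-slack (ℕ→ℚ d) slack (ℕ→ℚ-nonNeg d)
  where
  slack : ℕ→ℚ (a ℕ.+ d) - ℕ→ℚ a ≡ ℕ→ℚ d
  slack = trans (cong (_- ℕ→ℚ a) (ℕ→ℚ-+ a d)) (p+q-p≡q (ℕ→ℚ a) (ℕ→ℚ d))

ℕ→ℚ-mono-< : ∀ {a b} → a ℕ.< b → ℕ→ℚ a < ℕ→ℚ b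
ℕ→ℚ-mono-< {a} a<b = <-≤-trans a<1+a (ℕ→ℚ-mono-≤ a<b)
  where
  a<1+a : ℕ→ℚ a < ℕ→ℚ (suc a)
  a<1+a = subst₂ _<_ (+-identityˡ (ℕ→ℚ a)) (sym (ℕ→ℚ-suc a)) (+-monoˡ-< (ℕ→ℚ a) 0<1)

ℕ→ℚ-cancel-≤ : ∀ {a b} → ℕ→ℚ a ≤ ℕ→ℚ b → a ℕ.≤ b
ℕ→ℚ-cancel-≤ {a} {b} h with ℕₚ.≤-<-connex a b
... | inj₁ a≤b = a≤b
... | inj₂ b<a = ⊥-elim (<-irrefl refl (≤-<-trans h (ℕ→ℚ-mono-< b<a)))

sumℚ-cong : ∀ {m} {f g : Fin m → ℚ} → (∀ k → f k ≡ g k) → sumℚ f ≡ sumℚ g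
sumℚ-cong {zero}  f≗g = refl
sumℚ-cong {suc m} f≗g = cong₂ _+_ (f≗g zero) (sumℚ-cong (f≗g ∘ suc))

sumℚ-+ : ∀ {m} (f g : Fin m → ℚ) → sumℚ (λ k → f k + g k) ≡ sumℚ f + sumℚ g
sumℚ-+ {zero}  f g = refl
sumℚ-+ {suc m} f g = trans (cong (f zero + g zero +_) (sumℚ-+ (f ∘ suc) (g ∘ suc)))
  (+-interchange (f zero) (g zero) (sumℚ (f ∘ suc)) (sumℚ (g ∘ suc)))
  where +-interchange : ∀ a b c d → a + b + (c + d) ≡ a + c + (b + d)
        +-interchange = solve-∀ ℚ-ring

sumℚ-neg : ∀ {m} (f : Fin m → ℚ) → sumℚ (λ k → - f k) ≡ - sumℚ f
sumℚ-neg {zero}  f = refl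
sumℚ-neg {suc m} f = trans (cong (- f zero +_) (sumℚ-neg (f ∘ suc)))
  (sym (neg-distrib-+ (f zero) (sumℚ (f ∘ suc))))

sumℚ-- : ∀ {m} (f g : Fin m → ℚ) → sumℚ (λ k → f k - g k) ≡ sumℚ f - sumℚ g
sumℚ-- f g = trans (sumℚ-+ f (λ k → - g k)) (cong (sumℚ f +_) (sumℚ-neg g))

sumℚ-*ˡ : ∀ {m} (c : ℚ) (f : Fin m → ℚ) → sumℚ (λ k → c * f k) ≡ c * sumℚ f
sumℚ-*ˡ {zero}  c f = sym (*-zeroʳ c)
sumℚ-*ˡ {suc m} c f = trans (cong (c * f zero +_) (sumℚ-*ˡ c (f ∘ suc)))
  (sym (*-distribˡ-+ c (f zero) _))

sumℚ-const : ∀ {m} (c : ℚ) → sumℚ {m} (λ _ → c) ≡ ℕ→ℚ m * c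
sumℚ-const {zero}  c = sym (*-zeroˡ c)
sumℚ-const {suc m} c = begin
  c + sumℚ {m} (λ _ → c)   ≡⟨ cong (c +_) (sumℚ-const {m} c) ⟩
  c + ℕ→ℚ m * c            ≡⟨ c+a*c≡[1+a]*c c (ℕ→ℚ m) ⟩
  (1ℚ + ℕ→ℚ m) * c         ≡⟨ cong (_* c) (ℕ→ℚ-suc m) ⟨
  ℕ→ℚ (suc m) * c          ∎
  where open ≡-Reasoning
        c+a*c≡[1+a]*c : ∀ c a → c + a * c ≡ (1ℚ + a) * c
        c+a*c≡[1+a]*c = solve-∀ ℚ-ring

sumℚ-ones : ∀ m → sumℚ {m} (λ _ → 1ℚ) ≡ ℕ→ℚ m
sumℚ-ones m = trans (sumℚ-const {m} 1ℚ) (*-identityʳ (ℕ→ℚ m))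

sumℚ-zeros : ∀ m → sumℚ {m} (λ _ → 0ℚ) ≡ 0ℚ
sumℚ-zeros m = trans (sumℚ-const {m} 0ℚ) (*-zeroʳ (ℕ→ℚ m))

sumℚ-mono-≤ : ∀ {m} {f g : Fin m → ℚ} → (∀ k → f k ≤ g k) → sumℚ f ≤ sumℚ g
sumℚ-mono-≤ {zero}  f≤g = ≤-refl
sumℚ-mono-≤ {suc m} f≤g = +-mono-≤ (f≤g zero) (sumℚ-mono-≤ (f≤g ∘ suc))

sumℚ-nonNeg : ∀ {m} {f : Fin m → ℚ} → (∀ k → 0ℚ ≤ f k) → 0ℚ ≤ sumℚ f
sumℚ-nonNeg {m} {f} f≥0 = subst (_≤ sumℚ f) (sumℚ-zeros m) (sumℚ-mono-≤ f≥0)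

sumℚ-nonNeg-≤0⇒0 : ∀ {m} {f : Fin m → ℚ} → (∀ k → 0ℚ ≤ f k) → sumℚ f ≤ 0ℚ → ∀ k → f k ≡ 0ℚ
sumℚ-nonNeg-≤0⇒0 {suc m} {f} f≥0 Σf≤0 zero = nonNeg+nonNeg≤0⇒0 (f≥0 zero) (sumℚ-nonNeg (f≥0 ∘ suc)) Σf≤0
sumℚ-nonNeg-≤0⇒0 {suc m} {f} f≥0 Σf≤0 (suc k) = sumℚ-nonNeg-≤0⇒0 (f≥0 ∘ suc) tail≤0 k
  where
  f0≡0 : f zero ≡ 0ℚ
  f0≡0 = sumℚ-nonNeg-≤0⇒0 f≥0 Σf≤0 zero
  tail≤0 : sumℚ (f ∘ suc) ≤ 0ℚ
  tail≤0 = subst (_≤ 0ℚ) (trans (cong (_+ sumℚ (f ∘ suc)) f0≡0) (+-identityˡ _)) Σf≤0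

sumℚ-≤-squeeze : ∀ {m} {f g : Fin m → ℚ} → (∀ k → g k ≤ f k) → sumℚ f ≤ sumℚ g → ∀ k → f k ≡ g k
sumℚ-≤-squeeze {f = f} {g} g≤f Σf≤Σg k =
  sym (q-p≡0⇒p≡q (sumℚ-nonNeg-≤0⇒0 (p≤q⇒0≤q-p ∘ g≤f) Σ[f-g]≤0 k))
  where
  Σ[f-g]≤0 : sumℚ (λ k → f k - g k) ≤ 0ℚ
  Σ[f-g]≤0 = subst₂ _≤_ (sym (sumℚ-- f g)) (+-inverseʳ (sumℚ g)) (+-monoˡ-≤ (- sumℚ g) Σf≤Σg)

sumℚ-pos⇒∃pos : ∀ {m} (f : Fin m → ℚ) → 0ℚ < sumℚ f → ∃ λ k → 0ℚ < f k
sumℚ-pos⇒∃pos {zero}  f Σf>0 = ⊥-elim (<-irrefl refl Σf>0)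
sumℚ-pos⇒∃pos {suc m} f Σf>0 with 0ℚ <? f zero | 0ℚ <? sumℚ (f ∘ suc)
... | yes f0>0 | _          = zero , f0>0
... | no _     | yes tail>0 = Σ-map suc id (sumℚ-pos⇒∃pos (f ∘ suc) tail>0)
... | no f0≯0  | no tail≯0  =
  ⊥-elim (<-irrefl refl (<-≤-trans Σf>0 (+-nonPos (≮⇒≥ f0≯0) (≮⇒≥ tail≯0))))
  where +-nonPos : ∀ {p q} → p ≤ 0ℚ → q ≤ 0ℚ → p + q ≤ 0ℚ
        +-nonPos p≤0 q≤0 = +-mono-≤ p≤0 q≤0

sumℚ-swap : ∀ {a b} (F : Fin a → Fin b → ℚ) →
            sumℚ (λ i → sumℚ (F i)) ≡ sumℚ (λ w → sumℚ (λ i → F i w))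
sumℚ-swap {zero}  {b} F = sym (sumℚ-zeros b)
sumℚ-swap {suc a} F = trans (cong (sumℚ (F zero) +_) (sumℚ-swap (F ∘ suc)))
  (sym (sumℚ-+ (F zero) (λ w → sumℚ (λ i → F (suc i) w))))

sumℚ-last : ∀ {m} (f : Fin (suc m) → ℚ) → sumℚ f ≡ sumℚ (f ∘ inject₁) + f (fromℕ m)
sumℚ-last {zero}  f = +-comm (f zero) 0ℚ
sumℚ-last {suc m} f = trans (cong (f zero +_) (sumℚ-last (f ∘ suc)))
  (sym (+-assoc (f zero) (sumℚ (f ∘ suc ∘ inject₁)) (f (suc (fromℕ m)))))

module ℚ-Σ = MonoidSum +-0-commutativeMonoid

sumℚ≡Σ : ∀ {m} (f : Fin m → ℚ) → sumℚ f ≡ ℚ-Σ.sum f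
sumℚ≡Σ {zero}  f = refl
sumℚ≡Σ {suc m} f = cong (f zero +_) (sumℚ≡Σ (f ∘ suc))

sumℚ-reindex : ∀ {n n'} (π : Fin n ⤖ Fin n') (g : Fin n' → ℚ) →
               sumℚ g ≡ sumℚ (g ∘ Bijection.to π)
sumℚ-reindex π g = trans (sumℚ≡Σ g)
  (trans (ℚ-Σ.sum-permute g (⤖⇒↔ π)) (sym (sumℚ≡Σ (g ∘ Bijection.to π))))

δ : ∀ {m} → Fin m → Fin m → ℚ
δ j k = if does (j Fin.≟ k) then 1ℚ else 0ℚ

δ-refl : ∀ {m} (j : Fin m) → δ j j ≡ 1ℚ
δ-refl j with j Fin.≟ j
... | yes _  = refl
... | no j≢j = ⊥-elim (j≢j refl)

δ-≢ : ∀ {m} {j k : Fin m} → j ≢ k → δ j k ≡ 0ℚ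
δ-≢ {j = j} {k} j≢k with j Fin.≟ k
... | yes j≡k = ⊥-elim (j≢k j≡k)
... | no _    = refl

δ-nonNeg : ∀ {m} (j k : Fin m) → 0ℚ ≤ δ j k
δ-nonNeg j k with j Fin.≟ k
... | yes _ = 0≤1
... | no _  = ≤-refl

δ-sym : ∀ {m} (j k : Fin m) → δ j k ≡ δ k j
δ-sym j k with j Fin.≟ k
... | yes refl = sym (δ-refl j)
... | no j≢k   = sym (δ-≢ (j≢k ∘ sym))

sumℚ-δ : ∀ {m} (j : Fin m) (f : Fin m → ℚ) → sumℚ (λ k → δ j k * f k) ≡ f j
sumℚ-δ {suc m} zero f = begin
  1ℚ * f zero + sumℚ (λ k → 0ℚ * f (suc k))
    ≡⟨ cong₂ _+_ (*-identityˡ (f zero)) (trans (sumℚ-cong (λ k → *-zeroˡ (f (suc k)))) (sumℚ-zeros m)) ⟩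
  f zero + 0ℚ
    ≡⟨ +-identityʳ (f zero) ⟩
  f zero ∎
  where open ≡-Reasoning
sumℚ-δ {suc m} (suc j) f = begin
  0ℚ * f zero + sumℚ (λ k → δ j k * f (suc k))
    ≡⟨ cong₂ _+_ (*-zeroˡ (f zero)) (sumℚ-δ j (f ∘ suc)) ⟩
  0ℚ + f (suc j)
    ≡⟨ +-identityˡ (f (suc j)) ⟩
  f (suc j) ∎
  where open ≡-Reasoning

sumℚ-δ-one : ∀ {m} (j : Fin m) → sumℚ (δ j) ≡ 1ℚ
sumℚ-δ-one j = trans (sumℚ-cong (λ k → sym (*-identityʳ (δ j k)))) (sumℚ-δ j (λ _ → 1ℚ))

next : ∀ {N} → Fin (suc N) → Fin (suc N)
next {N} i with toℕ i ℕ.<? N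
... | yes i<N = suc (fromℕ< i<N)
... | no _    = zero

rimStep-next : ∀ {N} (i : Fin (suc N)) → RimStep i (next i)
rimStep-next {N} i with toℕ i ℕ.<? N
... | yes i<N = inj₁ (cong suc (Finₚ.toℕ-fromℕ< i<N))
... | no i≮N  = inj₂ (cong suc (ℕₚ.≤-antisym (ℕₚ.≤-pred (Finₚ.toℕ<n i)) (ℕₚ.≮⇒≥ i≮N)) , refl)

rimStep⇒≡next : ∀ {N} {i j : Fin (suc N)} → RimStep i j → j ≡ next i
rimStep⇒≡next {N} {i} {j} (inj₁ j≡1+i) with toℕ i ℕ.<? N
... | yes i<N = Finₚ.toℕ-injective (trans j≡1+i (cong suc (sym (Finₚ.toℕ-fromℕ< i<N))))
... | no i≮N  = ⊥-elim (i≮N (ℕₚ.≤-pred (subst (ℕ._< suc N) j≡1+i (Finₚ.toℕ<n j))))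
rimStep⇒≡next {N} {i} {j} (inj₂ (1+i≡1+N , j≡0)) with toℕ i ℕ.<? N
... | yes i<N = ⊥-elim (ℕₚ.<-irrefl (ℕₚ.suc-injective 1+i≡1+N) i<N)
... | no _    = Finₚ.toℕ-injective j≡0

next-inject₁ : ∀ {N} (k : Fin N) → next (inject₁ k) ≡ suc k
next-inject₁ k = sym (rimStep⇒≡next (inj₁ (cong suc (sym (Finₚ.toℕ-inject₁ k)))))

next-fromℕ : ∀ N → next (fromℕ N) ≡ zero
next-fromℕ N = sym (rimStep⇒≡next (inj₂ (cong suc (Finₚ.toℕ-fromℕ N) , refl)))

next-≢ : ∀ {N} → 1 ℕ.≤ N → (i : Fin (suc N)) → next i ≢ i
next-≢ 1≤N i next≡i with rimStep-next i
... | inj₁ 1+i≡i        = ℕₚ.1+n≢n (trans (sym 1+i≡i) (cong toℕ next≡i))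
... | inj₂ (1+i≡1+N , next≡0) =
  ℕₚ.<⇒≢ 1≤N (sym (trans (ℕₚ.suc-injective (sym 1+i≡1+N)) (trans (cong toℕ (sym next≡i)) next≡0)))

sumℚ-rotate : ∀ {N} (f : Fin (suc N) → ℚ) → sumℚ (f ∘ next) ≡ sumℚ f
sumℚ-rotate {N} f = begin
  sumℚ (f ∘ next)                                 ≡⟨ sumℚ-last (f ∘ next) ⟩
  sumℚ (f ∘ next ∘ inject₁) + f (next (fromℕ N))  ≡⟨ cong₂ _+_ (sumℚ-cong (cong f ∘ next-inject₁))
                                                                (cong f (next-fromℕ N)) ⟩
  sumℚ (f ∘ suc) + f zero                         ≡⟨ +-comm (sumℚ (f ∘ suc)) (f zero) ⟩
  sumℚ f                                          ∎
  where open ≡-Reasoning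

sumℚ-edgeSums : ∀ {N} (f : Fin (suc N) → ℚ) → sumℚ (λ p → f p + f (next p)) ≡ sumℚ f + sumℚ f
sumℚ-edgeSums f = trans (sumℚ-+ f (f ∘ next)) (cong (sumℚ f +_) (sumℚ-rotate f))

sumℚ-edgeExcesses : ∀ {N} (f : Fin (suc N) → ℚ) →
                    sumℚ (λ p → f p + f (next p) - 1ℚ) ≡ sumℚ f + sumℚ f - ℕ→ℚ (suc N)
sumℚ-edgeExcesses {N} f = trans (sumℚ-- (λ p → f p + f (next p)) (λ _ → 1ℚ))
  (cong₂ _-_ (sumℚ-edgeSums f) (sumℚ-ones (suc N)))

module _ {n} {G : Graph n} where

  oddCycle-edge : (ω : OddCycle G) → ∀ k → G (OddCycle.vert ω k) (OddCycle.vert ω (next k))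
  oddCycle-edge ω k with rimStep-next k
  ... | inj₁ next≡1+k = OddCycle.step ω k (next k) next≡1+k
  ... | inj₂ (1+k≡1+2s , next≡0) =
    subst₂ (λ a b → G (OddCycle.vert ω a) (OddCycle.vert ω b)) k≡last (sym next≡zero) (OddCycle.close ω)
    where
    k≡last : fromℕ (2 ℕ.* OddCycle.s ω) ≡ k
    k≡last = Finₚ.toℕ-injective (trans (Finₚ.toℕ-fromℕ _) (sym (ℕₚ.suc-injective 1+k≡1+2s)))
    next≡zero : next k ≡ zero
    next≡zero = Finₚ.toℕ-injective next≡0

  cyclicOddCycle : ∀ s → 1 ℕ.≤ s → (R : Fin (suc (2 ℕ.* s)) → Fin n) →
                   (∀ {p q} → R p ≡ R q → p ≡ q) → (∀ p → G (R p) (R (next p))) → OddCycle G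
  cyclicOddCycle s s≥1 R R-injective R-edge = record
    { s = s ; s≥1 = s≥1 ; vert = R ; inj = R-injective
    ; step  = λ p q q≡1+p → subst (G (R p) ∘ R) (sym (rimStep⇒≡next (inj₁ q≡1+p))) (R-edge p)
    ; close = subst (G (R (fromℕ (2 ℕ.* s))) ∘ R) (next-fromℕ (2 ℕ.* s)) (R-edge (fromℕ _)) }

  triangle : ∀ {a b c} → G a b → G b c → G c a → a ≢ b → b ≢ c → a ≢ c → OddCycle G
  triangle {a} {b} {c} ab bc ca a≢b b≢c a≢c = cyclicOddCycle 1 ℕₚ.≤-refl vertex vertex-injective edge
    where
    vertex : Fin 3 → Fin n
    vertex zero             = a
    vertex (suc zero)       = b
    vertex (suc (suc zero)) = c
    vertex-injective : ∀ {p q} → vertex p ≡ vertex q → p ≡ q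
    vertex-injective {zero}             {zero}             _ = refl
    vertex-injective {zero}             {suc zero}         e = ⊥-elim (a≢b e)
    vertex-injective {zero}             {suc (suc zero)}   e = ⊥-elim (a≢c e)
    vertex-injective {suc zero}         {zero}             e = ⊥-elim (a≢b (sym e))
    vertex-injective {suc zero}         {suc zero}         _ = refl
    vertex-injective {suc zero}         {suc (suc zero)}   e = ⊥-elim (b≢c e)
    vertex-injective {suc (suc zero)}   {zero}             e = ⊥-elim (a≢c (sym e))
    vertex-injective {suc (suc zero)}   {suc zero}         e = ⊥-elim (b≢c (sym e))
    vertex-injective {suc (suc zero)}   {suc (suc zero)}   _ = refl
    edge : ∀ p → G (vertex p) (vertex (next p))
    edge zero             = ab
    edge (suc zero)       = bc
    edge (suc (suc zero)) = ca

IsZeroOne : ∀ {n} → (Fin n → ℚ) → Set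
IsZeroOne y = ∀ k → (y k ≡ 0ℚ) ⊎ (y k ≡ 1ℚ)

Covers : ∀ {n} → Graph n → (Fin n → ℚ) → Set
Covers G y = ∀ u v → G u v → 1ℚ ≤ y u + y v

zeroOne-nonNeg : ∀ {n} {y : Fin n → ℚ} → IsZeroOne y → ∀ v → 0ℚ ≤ y v
zeroOne-nonNeg y01 v with y01 v
... | inj₁ yv≡0 = ≤-reflexive (sym yv≡0)
... | inj₂ yv≡1 = subst (0ℚ ≤_) (sym yv≡1) 0≤1

sumℚ-zeroOne : ∀ {m} (g : Fin m → ℚ) → IsZeroOne g → ∃ λ c → sumℚ g ≡ ℕ→ℚ c
sumℚ-zeroOne {zero}  g g01 = 0 , refl
sumℚ-zeroOne {suc m} g g01 with sumℚ-zeroOne (g ∘ suc) (g01 ∘ suc) | g01 zero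
... | c , Σ≡c | inj₁ g0≡0 = c , trans (cong₂ _+_ g0≡0 Σ≡c) (+-identityˡ _)
... | c , Σ≡c | inj₂ g0≡1 = suc c , trans (cong₂ _+_ g0≡1 Σ≡c) (sym (ℕ→ℚ-suc c))

-- Summing the edge constraints shows 2 Σ g ≥ N + 1; integrality of Σ g then gives Σ g ≥ ⌈(N + 1)/2⌉.
cyclicCover-≥ : ∀ {N} (g : Fin (suc N) → ℚ) → IsZeroOne g → (∀ k → 1ℚ ≤ g k + g (next k)) →
                ∀ L → L ℕ.+ L ℕ.≤ suc (suc N) → ℕ→ℚ L ≤ sumℚ g
cyclicCover-≥ {N} g g01 g-edge L 2L≤N+2 with sumℚ-zeroOne g g01
... | c , Σg≡c = subst (ℕ→ℚ L ≤_) (sym Σg≡c) (ℕ→ℚ-mono-≤ L≤c)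
  where
  N+1≤2c : suc N ℕ.≤ c ℕ.+ c
  N+1≤2c = ℕ→ℚ-cancel-≤ (subst₂ _≤_ (sumℚ-ones (suc N))
    (trans (sumℚ-edgeSums g) (trans (cong₂ _+_ Σg≡c Σg≡c) (sym (ℕ→ℚ-+ c c))))
    (sumℚ-mono-≤ g-edge))
  L≤c : L ℕ.≤ c
  L≤c with ℕₚ.≤-<-connex L c
  ... | inj₁ L≤c = L≤c
  ... | inj₂ c<L = ⊥-elim (ℕₚ.<-irrefl refl (begin-strict
    suc (suc (c ℕ.+ c))    ≡⟨ cong suc (ℕₚ.+-suc c c) ⟨
    suc c ℕ.+ suc c        ≤⟨ ℕₚ.+-mono-≤ c<L c<L ⟩
    L ℕ.+ L                ≤⟨ 2L≤N+2 ⟩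
    suc (suc N)            ≤⟨ ℕ.s≤s N+1≤2c ⟩
    suc (c ℕ.+ c)          <⟨ ℕₚ.n<1+n _ ⟩
    suc (suc (c ℕ.+ c))    ∎))
    where open ℕₚ.≤-Reasoning

zeroOne-cover-oddCycle : ∀ {n} {G : Graph n} {y : Fin n → ℚ} → IsZeroOne y → Covers G y →
                         (ω : OddCycle G) → ℕ→ℚ (suc (OddCycle.s ω)) ≤ sumℚ (y ∘ OddCycle.vert ω)
zeroOne-cover-oddCycle y01 y-covers ω = cyclicCover-≥ _ (y01 ∘ OddCycle.vert ω)
  (λ k → y-covers _ _ (oddCycle-edge ω k)) (suc s) (ℕₚ.≤-reflexive 2+2s≡2+2*s)
  where
  s = OddCycle.s ω
  2+2s≡2+2*s : suc s ℕ.+ suc s ≡ suc (suc (2 ℕ.* s))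
  2+2s≡2+2*s = cong suc (trans (ℕₚ.+-suc s s) (cong (λ t → ℕ.suc (s ℕ.+ t)) (sym (ℕₚ.+-identityʳ s))))

sameEdge? : ∀ {n} (u v r s : Fin n) → Dec (SameEdge u v r s)
sameEdge? u v r s = (u Fin.≟ r ×-dec v Fin.≟ s) ⊎-dec (u Fin.≟ s ×-dec v Fin.≟ r)

feasible⇒covers : ∀ {n} {G : Graph n} {r s} {x : Fin n → ℚ} → RELPFeasible G r s x → Covers G x
feasible⇒covers {r = r} {s} {x} x-feasible u v uv with sameEdge? u v r s
... | no ¬rs                 = RELPFeasible.edge x-feasible u v uv ¬rs
... | yes (inj₁ (refl , refl)) = ≤-reflexive (sym (RELPFeasible.eqn x-feasible))
... | yes (inj₂ (refl , refl)) = ≤-reflexive (sym (trans (+-comm (x s) (x r)) (RELPFeasible.eqn x-feasible)))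

zeroOne-cover⇒feasible : ∀ {n} {G : Graph n} {r s} {y : Fin n → ℚ} →
                         IsZeroOne y → Covers G y → y r + y s ≡ 1ℚ → RELPFeasible G r s y
zeroOne-cover⇒feasible y01 y-covers yr+ys≡1 = record
  { edge   = λ u v uv _ → y-covers u v uv
  ; eqn    = yr+ys≡1
  ; cycle  = zeroOne-cover-oddCycle y01 y-covers
  ; nonneg = zeroOne-nonNeg y01
  }

feasible-triangle : ∀ {n} {G : Graph n} {r s} {x : Fin n → ℚ} → RELPFeasible G r s x →
                    ∀ {a b c} → G a b → G b c → G c a → a ≢ b → b ≢ c → a ≢ c →
                    1ℚ + 1ℚ ≤ x a + (x b + x c)
feasible-triangle {x = x} x-feasible {a} {b} {c} ab bc ca a≢b b≢c a≢c =
  subst (1ℚ + 1ℚ ≤_) (cong (λ t → x a + (x b + t)) (+-identityʳ (x c)))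
    (RELPFeasible.cycle x-feasible (triangle ab bc ca a≢b b≢c a≢c))

feasible-cyclic : ∀ {n} {G : Graph n} {r r'} {x : Fin n → ℚ} → RELPFeasible G r r' x →
                  ∀ {N} s → N ≡ 2 ℕ.* s → 1 ℕ.≤ s → (R : Fin (suc N) → Fin n) →
                  (∀ {p q} → R p ≡ R q → p ≡ q) → (∀ p → G (R p) (R (next p))) →
                  ℕ→ℚ (suc s) ≤ sumℚ (x ∘ R)
feasible-cyclic x-feasible s refl s≥1 R R-injective R-edge =
  RELPFeasible.cycle x-feasible (cyclicOddCycle s s≥1 R R-injective R-edge)

-- Integrality of basic solutions lying in the convex hull of 0/1 covers

record ConvexCombinationOfCovers {n} (G : Graph n) (x : Fin n → ℚ) : Set where
  field
    size          : ℕ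
    weight        : Fin size → ℚ
    cover         : Fin size → Fin n → ℚ
    weight-nonNeg : ∀ w → 0ℚ ≤ weight w
    weight-sum    : sumℚ weight ≡ 1ℚ
    cover-zeroOne : ∀ w → IsZeroOne (cover w)
    cover-covers  : ∀ w → Covers G (cover w)
    decomposition : ∀ v → x v ≡ sumℚ (λ w → weight w * cover w v)

convexCombination-tight : ∀ {W} (l a : Fin W → ℚ) (b : ℚ) → (∀ w → 0ℚ ≤ l w) → sumℚ l ≡ 1ℚ →
                          (∀ w → b ≤ a w) → sumℚ (λ w → l w * a w) ≡ b → ∀ w → 0ℚ < l w → a w ≡ b
convexCombination-tight l a b l≥0 Σl≡1 b≤a Σla≡b w lw>0 = sym (q-p≡0⇒p≡q a[w]-b≡0)
  where
  excess : Fin _ → ℚ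
  excess w = l w * (a w - b)
  excess-nonNeg : ∀ w → 0ℚ ≤ excess w
  excess-nonNeg w = *-nonNeg (l≥0 w) (p≤q⇒0≤q-p (b≤a w))
  Σexcess≡0 : sumℚ excess ≡ 0ℚ
  Σexcess≡0 = begin
    sumℚ excess                               ≡⟨ sumℚ-cong (λ w → distrib (l w) (a w) b) ⟩
    sumℚ (λ w → l w * a w - b * l w)          ≡⟨ sumℚ-- (λ w → l w * a w) (λ w → b * l w) ⟩
    sumℚ (λ w → l w * a w) - sumℚ (λ w → b * l w) ≡⟨ cong₂ _-_ Σla≡b (trans (sumℚ-*ˡ b l) (cong (b *_) Σl≡1)) ⟩
    b - b * 1ℚ                                ≡⟨ b-b*1≡0 b ⟩
    0ℚ                                        ∎
    where open ≡-Reasoning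
          distrib : ∀ l a b → l * (a - b) ≡ l * a - b * l
          distrib = solve-∀ ℚ-ring
          b-b*1≡0 : ∀ b → b - b * 1ℚ ≡ 0ℚ
          b-b*1≡0 = solve-∀ ℚ-ring
  a[w]-b≡0 : a w - b ≡ 0ℚ
  a[w]-b≡0 = ≤-antisym
    (*-cancelˡ-≤-pos (l w) {{positive lw>0}}
      (subst (l w * (a w - b) ≤_) (sym (*-zeroʳ (l w)))
        (≤-reflexive (sumℚ-nonNeg-≤0⇒0 excess-nonNeg (≤-reflexive Σexcess≡0) w))))
    (p≤q⇒0≤q-p (b≤a w))

basicFeasible-convexCombination⇒zeroOne :
  ∀ {n} {G : Graph n} {r s : Fin n} {x : Fin n → ℚ} → G r s → IsBasicFeasible G r s x →
  ConvexCombinationOfCovers G x → IsZeroOne x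
basicFeasible-convexCombination⇒zeroOne {n} {G} {r} {s} {x} rs (x-feasible , x-basic) hull = x01
  where
  open ConvexCombinationOfCovers hull
  positive-weight : ∃ λ w → 0ℚ < weight w
  positive-weight = sumℚ-pos⇒∃pos weight (subst (0ℚ <_) (sym weight-sum) 0<1)
  w₀ : Fin size
  w₀ = proj₁ positive-weight
  y : Fin n → ℚ
  y = cover w₀
  tight-at-y : (a : Fin size → ℚ) (b : ℚ) → (∀ w → b ≤ a w) → sumℚ (λ w → weight w * a w) ≡ b → a w₀ ≡ b
  tight-at-y a b b≤a Σ≡b =
    convexCombination-tight weight a b weight-nonNeg weight-sum b≤a Σ≡b w₀ (proj₂ positive-weight)
  d : Fin n → ℚ
  d v = y v - x v
  difference-zero : ∀ {p q b} → q ≡ b → p ≡ b → p - q ≡ 0ℚ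
  difference-zero {p} refl refl = +-inverseʳ p
  edge-tight : ∀ u v → G u v → x u + x v ≡ 1ℚ → d u + d v ≡ 0ℚ
  edge-tight u v uv xu+xv≡1 = trans (rearrange-diff (y u) (y v) (x u) (x v))
    (difference-zero xu+xv≡1 (tight-at-y (λ w → cover w u + cover w v) 1ℚ (λ w → cover-covers w u v uv)
      (trans (sym x-pair) xu+xv≡1)))
    where
    rearrange-diff : ∀ a b c e → (a - c) + (b - e) ≡ (a + b) - (c + e)
    rearrange-diff = solve-∀ ℚ-ring
    x-pair : x u + x v ≡ sumℚ (λ w → weight w * (cover w u + cover w v))
    x-pair = trans (cong₂ _+_ (decomposition u) (decomposition v))
      (trans (sym (sumℚ-+ (λ w → weight w * cover w u) (λ w → weight w * cover w v)))
        (sumℚ-cong (λ w → sym (*-distribˡ-+ (weight w) (cover w u) (cover w v)))))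
  cycle-tight : (ω : OddCycle G) → sumℚ (x ∘ OddCycle.vert ω) ≡ ℕ→ℚ (suc (OddCycle.s ω)) →
                sumℚ (d ∘ OddCycle.vert ω) ≡ 0ℚ
  cycle-tight ω Σx≡s+1 = trans (sumℚ-- (y ∘ OddCycle.vert ω) (x ∘ OddCycle.vert ω))
    (difference-zero Σx≡s+1 (tight-at-y (λ w → sumℚ (cover w ∘ OddCycle.vert ω)) _
      (λ w → zeroOne-cover-oddCycle (cover-zeroOne w) (cover-covers w) ω) (trans (sym x-cycle) Σx≡s+1)))
    where
    x-cycle : sumℚ (x ∘ OddCycle.vert ω) ≡ sumℚ (λ w → weight w * sumℚ (cover w ∘ OddCycle.vert ω))
    x-cycle = trans (sumℚ-cong (decomposition ∘ OddCycle.vert ω))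
      (trans (sumℚ-swap (λ i w → weight w * cover w (OddCycle.vert ω i)))
        (sumℚ-cong (λ w → sumℚ-*ˡ (weight w) (cover w ∘ OddCycle.vert ω))))
  zero-tight : ∀ v → x v ≡ 0ℚ → d v ≡ 0ℚ
  zero-tight v xv≡0 = difference-zero xv≡0
    (tight-at-y (λ w → cover w v) 0ℚ (λ w → zeroOne-nonNeg (cover-zeroOne w) v)
      (trans (sym (decomposition v)) xv≡0))
  d≡0 : ∀ v → d v ≡ 0ℚ
  d≡0 = x-basic d (λ u v uv _ → edge-tight u v uv) (edge-tight r s rs (RELPFeasible.eqn x-feasible))
    cycle-tight zero-tight
  x01 : IsZeroOne x
  x01 v with cover-zeroOne w₀ v
  ... | inj₁ yv≡0 = inj₁ (trans (q-p≡0⇒p≡q (d≡0 v)) yv≡0)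
  ... | inj₂ yv≡1 = inj₂ (trans (q-p≡0⇒p≡q (d≡0 v)) yv≡1)

-- From an optimal 0/1 solution to a minimum vertex cover

indicator : ∀ {n} → Subset n → Fin n → ℚ
indicator D k = if lookup D k then 1ℚ else 0ℚ

indicator-zeroOne : ∀ {n} (D : Subset n) → IsZeroOne (indicator D)
indicator-zeroOne D k with lookup D k
... | true  = inj₂ refl
... | false = inj₁ refl

indicator-∈ : ∀ {n} {D : Subset n} {k} → k ∈ D → indicator D k ≡ 1ℚ
indicator-∈ k∈D rewrite Vecₚ.[]=⇒lookup k∈D = refl

sumℚ-indicator : ∀ {n} (D : Subset n) → sumℚ (indicator D) ≡ ℕ→ℚ ∣ D ∣
sumℚ-indicator []          = refl
sumℚ-indicator (true ∷ D)  = trans (cong (1ℚ +_) (sumℚ-indicator D)) (sym (ℕ→ℚ-suc ∣ D ∣))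
sumℚ-indicator (false ∷ D) = trans (+-identityˡ _) (sumℚ-indicator D)

vertexCover⇒covers : ∀ {n} {G : Graph n} {D : Subset n} → IsVertexCover G D → Covers G (indicator D)
vertexCover⇒covers {D = D} D-cover u v uv with D-cover u v uv
... | inj₁ u∈D = subst (λ z → 1ℚ ≤ z + indicator D v) (sym (indicator-∈ u∈D))
                  (p≤p+q (zeroOne-nonNeg (indicator-zeroOne D) v))
... | inj₂ v∈D = subst (λ z → 1ℚ ≤ indicator D u + z) (sym (indicator-∈ v∈D))
                  (p≤q+p (zeroOne-nonNeg (indicator-zeroOne D) u))

support : ∀ {n} → (Fin n → ℚ) → Subset n
support x = tabulate (λ k → does (x k ≟ 1ℚ))

∈-support⇒≡1 : ∀ {n} (x : Fin n → ℚ) {k} → k ∈ support x → x k ≡ 1ℚ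
∈-support⇒≡1 x {k} k∈ with x k ≟ 1ℚ | Vecₚ.[]=⇒lookup k∈ | Vecₚ.lookup∘tabulate (λ k → does (x k ≟ 1ℚ)) k
... | yes xk≡1 | _ | _ = xk≡1
... | no _     | lookup≡true | lookup≡false = contradiction (trans (sym lookup≡true) lookup≡false) λ ()

≡1⇒∈-support : ∀ {n} (x : Fin n → ℚ) {k} → x k ≡ 1ℚ → k ∈ support x
≡1⇒∈-support x {k} xk≡1 = Vecₚ.lookup⇒[]= k (support x)
  (trans (Vecₚ.lookup∘tabulate (λ k → does (x k ≟ 1ℚ)) k) (dec-true (x k ≟ 1ℚ) xk≡1))

zeroOne≡indicator-support : ∀ {n} {x : Fin n → ℚ} → IsZeroOne x → ∀ k → x k ≡ indicator (support x) k
zeroOne≡indicator-support {x = x} x01 k with x01 k | lookup (support x) k in eq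
... | inj₁ xk≡0 | false = xk≡0
... | inj₁ xk≡0 | true  = contradiction (trans (sym xk≡0) (∈-support⇒≡1 x (Vecₚ.lookup⇒[]= k (support x) eq))) λ ()
... | inj₂ xk≡1 | true  = xk≡1
... | inj₂ xk≡1 | false = contradiction (trans (sym eq) (Vecₚ.[]=⇒lookup (≡1⇒∈-support x xk≡1))) λ ()

IsIntegralMinCover : ∀ {n} → Graph n → (Fin n → ℚ) → Set
IsIntegralMinCover {n} G x =
  (∀ k → (x k ≡ 0ℚ) ⊎ (x k ≡ 1ℚ)) ×
  (Σ[ C ∈ Subset n ] (∀ k → (k ∈ C → x k ≡ 1ℚ) × (k ∉ C → x k ≡ 0ℚ)) × IsMinVertexCover G C)

zeroOne-bounded⇒integralMinCover :
  ∀ {n} {G : Graph n} {r s} {x : Fin n → ℚ} → RELPFeasible G r s x → IsZeroOne x →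
  (B : ℚ) → sumℚ x ≤ B → (∀ y → IsZeroOne y → Covers G y → B ≤ sumℚ y) → IsIntegralMinCover G x
zeroOne-bounded⇒integralMinCover {n} {G} {x = x} x-feasible x01 B Σx≤B B≤cover =
  x01 , support x , membership , (support-cover , support-minimal)
  where
  membership : ∀ k → (k ∈ support x → x k ≡ 1ℚ) × (k ∉ support x → x k ≡ 0ℚ)
  membership k = ∈-support⇒≡1 x , λ k∉ → [ id , (λ xk≡1 → ⊥-elim (k∉ (≡1⇒∈-support x xk≡1))) ]′ (x01 k)
  support-cover : IsVertexCover G (support x)
  support-cover u v uv with x01 u | x01 v
  ... | inj₂ xu≡1 | _         = inj₁ (≡1⇒∈-support x xu≡1)
  ... | _         | inj₂ xv≡1 = inj₂ (≡1⇒∈-support x xv≡1)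
  ... | inj₁ xu≡0 | inj₁ xv≡0 = ⊥-elim (<-irrefl refl (<-≤-trans 0<1
    (subst (1ℚ ≤_) (trans (cong₂ _+_ xu≡0 xv≡0) (+-identityˡ 0ℚ)) (feasible⇒covers x-feasible u v uv))))
  support-minimal : ∀ D → IsVertexCover G D → ∣ support x ∣ ℕ.≤ ∣ D ∣
  support-minimal D D-cover = ℕ→ℚ-cancel-≤ (subst₂ _≤_
    (trans (sumℚ-cong (zeroOne≡indicator-support x01)) (sumℚ-indicator (support x))) (sumℚ-indicator D)
    (≤-trans Σx≤B (B≤cover (indicator D) (indicator-zeroOne D) (vertexCover⇒covers D-cover))))

-- Complete graphs

allBut : ∀ {n} → Fin n → Fin n → ℚ
allBut w k = 1ℚ - δ w k

allBut-self : ∀ {n} (w : Fin n) → allBut w w ≡ 0ℚ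
allBut-self w = trans (cong (_-_ 1ℚ) (δ-refl w)) (+-inverseʳ 1ℚ)

allBut-≢ : ∀ {n} {w k : Fin n} → w ≢ k → allBut w k ≡ 1ℚ
allBut-≢ w≢k = cong (_-_ 1ℚ) (δ-≢ w≢k)

allBut-cases : ∀ {n} (w k : Fin n) → (w ≡ k × allBut w k ≡ 0ℚ) ⊎ (w ≢ k × allBut w k ≡ 1ℚ)
allBut-cases w k with w Fin.≟ k
... | yes w≡k = inj₁ (w≡k , refl)
... | no w≢k  = inj₂ (w≢k , refl)

allBut-zeroOne : ∀ {n} (w : Fin n) → IsZeroOne (allBut w)
allBut-zeroOne w k = ⊎-map proj₂ proj₂ (allBut-cases w k)

sumℚ-allBut : ∀ {n} (w : Fin n) → sumℚ (allBut w) ≡ ℕ→ℚ n - 1ℚ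
sumℚ-allBut {n} w = trans (sumℚ-- (λ _ → 1ℚ) (δ w)) (cong₂ _-_ (sumℚ-ones n) (sumℚ-δ-one w))

module _ {n} {G : Graph n} (complete : IsComplete G) where

  allBut-covers : ∀ w → Covers G (allBut w)
  allBut-covers w u v uv with allBut-cases w u
  ... | inj₁ (refl , _)     = subst (1ℚ ≤_) (sym (cong (allBut w w +_) (allBut-≢ (proj₁ (complete w v) uv))))
                                (p≤q+p (zeroOne-nonNeg (allBut-zeroOne w) w))
  ... | inj₂ (_ , allBut≡1) = subst (1ℚ ≤_) (sym (cong (_+ allBut w v) allBut≡1))
                                (p≤p+q (zeroOne-nonNeg (allBut-zeroOne w) v))

  -- A 0/1 cover of K_n omits at most one vertex.
  complete-cover-≥ : ∀ y → IsZeroOne y → Covers G y → ℕ→ℚ n - 1ℚ ≤ sumℚ y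
  complete-cover-≥ y y01 y-covers with Finₚ.any? (λ w → y w ≟ 0ℚ)
  ... | yes (w , yw≡0) = subst (_≤ sumℚ y) (sumℚ-allBut w) (sumℚ-mono-≤ allBut≤y)
    where
    allBut≤y : ∀ v → allBut w v ≤ y v
    allBut≤y v with allBut-cases w v
    ... | inj₁ (refl , allBut≡0) = subst (_≤ y w) (sym allBut≡0) (zeroOne-nonNeg y01 w)
    ... | inj₂ (w≢v , allBut≡1)  = subst₂ _≤_ (sym allBut≡1) (trans (cong (_+ y v) yw≡0) (+-identityˡ (y v)))
                                     (y-covers w v (proj₂ (complete w v) w≢v))
  ... | no ∄zero = ≤-trans (≤-by-slack 1ℚ (p-[p-1]≡1 (ℕ→ℚ n)) 0≤1) Σy≥n
    where
    p-[p-1]≡1 : ∀ p → p - (p - 1ℚ) ≡ 1ℚ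
    p-[p-1]≡1 = solve-∀ ℚ-ring
    Σy≥n : ℕ→ℚ n ≤ sumℚ y
    Σy≥n = subst (_≤ sumℚ y) (sumℚ-ones n) (sumℚ-mono-≤ λ v →
      [ (λ yv≡0 → ⊥-elim (∄zero (v , yv≡0))) , (λ yv≡1 → ≤-reflexive (sym yv≡1)) ]′ (y01 v))

  complete-integralMinCover : ∀ {i j} → G i j → ∀ {x} → IsBasicFeasible G i j x → IsOptimal G i j x →
                              IsIntegralMinCover G x
  complete-integralMinCover {i} {j} ij {x} x-bfs (x-feasible , x-optimal) =
    zeroOne-bounded⇒integralMinCover x-feasible x01 (ℕ→ℚ n - 1ℚ) Σx≤n-1 complete-cover-≥
    where
    i≢j : i ≢ j
    i≢j = proj₁ (complete i j) ij
    xi+xj≡1 : x i + x j ≡ 1ℚ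
    xi+xj≡1 = RELPFeasible.eqn x-feasible
    Σx≤n-1 : sumℚ x ≤ ℕ→ℚ n - 1ℚ
    Σx≤n-1 = subst (sumℚ x ≤_) (sumℚ-allBut i) (x-optimal (allBut i)
      (zeroOne-cover⇒feasible (allBut-zeroOne i) (allBut-covers i)
        (trans (cong₂ _+_ (allBut-self i) (allBut-≢ i≢j)) (+-identityˡ 1ℚ))))
    z : Fin n → ℚ
    z k = x i * allBut j k + x j * allBut i k
    z-at : ∀ {k a b} → allBut j k ≡ a → allBut i k ≡ b → z k ≡ x i * a + x j * b
    z-at = cong₂ (λ a b → x i * a + x j * b)
    z≤x : ∀ k → z k ≤ x k
    z≤x k with allBut-cases j k | allBut-cases i k
    ... | inj₁ (refl , _)    | inj₁ (refl , _)   = ⊥-elim (i≢j refl)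
    ... | inj₂ (_ , aj≡1)    | inj₁ (refl , ai≡0) = ≤-reflexive (trans (z-at aj≡1 ai≡0) (p*1+q*0≡p (x i) (x j)))
      where p*1+q*0≡p : ∀ p q → p * 1ℚ + q * 0ℚ ≡ p
            p*1+q*0≡p = solve-∀ ℚ-ring
    ... | inj₁ (refl , aj≡0) | inj₂ (_ , ai≡1)    = ≤-reflexive (trans (z-at aj≡0 ai≡1) (p*0+q*1≡q (x i) (x j)))
      where p*0+q*1≡q : ∀ p q → p * 0ℚ + q * 1ℚ ≡ q
            p*0+q*1≡q = solve-∀ ℚ-ring
    ... | inj₂ (j≢k , aj≡1)  | inj₂ (i≢k , ai≡1) =
      subst (_≤ x k) (sym (trans (z-at aj≡1 ai≡1) (trans (p*1+q*1≡p+q (x i) (x j)) xi+xj≡1)))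
        (≤-by-slack (x i + (x j + x k) - (1ℚ + 1ℚ)) (slack (x i) (x j) (x k) xi+xj≡1)
          (p≤q⇒0≤q-p (feasible-triangle x-feasible ij (adjacent j≢k) (adjacent (i≢k ∘ sym)) i≢j j≢k i≢k)))
      where
      adjacent : ∀ {u v} → u ≢ v → G u v
      adjacent = proj₂ (complete _ _)
      p*1+q*1≡p+q : ∀ p q → p * 1ℚ + q * 1ℚ ≡ p + q
      p*1+q*1≡p+q = solve-∀ ℚ-ring
      slack : ∀ p q r → p + q ≡ 1ℚ → r - 1ℚ ≡ p + (q + r) - (1ℚ + 1ℚ)
      slack p q r p+q≡1 = begin
        r - 1ℚ                     ≡⟨ r-1≡1+r-2 r ⟩
        1ℚ + r - (1ℚ + 1ℚ)         ≡⟨ cong (λ t → t + r - (1ℚ + 1ℚ)) p+q≡1 ⟨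
        p + q + r - (1ℚ + 1ℚ)      ≡⟨ cong (_- (1ℚ + 1ℚ)) (+-assoc p q r) ⟩
        p + (q + r) - (1ℚ + 1ℚ)    ∎
        where open ≡-Reasoning
              r-1≡1+r-2 : ∀ r → r - 1ℚ ≡ 1ℚ + r - (1ℚ + 1ℚ)
              r-1≡1+r-2 = solve-∀ ℚ-ring
    Σz≡n-1 : sumℚ z ≡ ℕ→ℚ n - 1ℚ
    Σz≡n-1 = begin
      sumℚ z                                         ≡⟨ sumℚ-+ (λ k → x i * allBut j k) (λ k → x j * allBut i k) ⟩
      sumℚ (λ k → x i * allBut j k) + sumℚ (λ k → x j * allBut i k)
        ≡⟨ cong₂ _+_ (trans (sumℚ-*ˡ (x i) (allBut j)) (cong (x i *_) (sumℚ-allBut j)))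
                     (trans (sumℚ-*ˡ (x j) (allBut i)) (cong (x j *_) (sumℚ-allBut i))) ⟩
      x i * (ℕ→ℚ n - 1ℚ) + x j * (ℕ→ℚ n - 1ℚ)       ≡⟨ *-distribʳ-+ (ℕ→ℚ n - 1ℚ) (x i) (x j) ⟨
      (x i + x j) * (ℕ→ℚ n - 1ℚ)                     ≡⟨ cong (_* (ℕ→ℚ n - 1ℚ)) xi+xj≡1 ⟩
      1ℚ * (ℕ→ℚ n - 1ℚ)                               ≡⟨ *-identityˡ _ ⟩
      ℕ→ℚ n - 1ℚ                                      ∎
      where open ≡-Reasoning
    x≡z : ∀ k → x k ≡ z k
    x≡z = sumℚ-≤-squeeze z≤x (≤-trans Σx≤n-1 (≤-reflexive (sym Σz≡n-1)))
    hull : ConvexCombinationOfCovers G x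
    hull = record
      { size          = 2
      ; weight        = λ { zero → x i ; (suc zero) → x j }
      ; cover         = λ { zero → allBut j ; (suc zero) → allBut i }
      ; weight-nonNeg = λ { zero       → RELPFeasible.nonneg x-feasible i
                          ; (suc zero) → RELPFeasible.nonneg x-feasible j }
      ; weight-sum    = trans (cong (x i +_) (+-identityʳ (x j))) xi+xj≡1
      ; cover-zeroOne = λ { zero → allBut-zeroOne j ; (suc zero) → allBut-zeroOne i }
      ; cover-covers  = λ { zero → allBut-covers j ; (suc zero) → allBut-covers i }
      ; decomposition = λ k → trans (x≡z k) (cong (x i * allBut j k +_) (sym (+-identityʳ _)))
      }
    x01 : IsZeroOne x
    x01 = basicFeasible-convexCombination⇒zeroOne ij x-bfs hull

-- Alternating 0/1 vectors on a cycle

isEven : ℕ → Bool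
isEven zero    = true
isEven (suc k) = not (isEven k)

evenOrOdd : ∀ M → (∃ λ s → M ≡ s ℕ.+ s × isEven M ≡ true) ⊎ (∃ λ s → M ≡ suc (s ℕ.+ s) × isEven M ≡ false)
evenOrOdd zero    = inj₁ (0 , refl , refl)
evenOrOdd (suc M) with evenOrOdd M
... | inj₁ (s , M≡2s , M-even)  = inj₂ (s , cong suc M≡2s , cong not M-even)
... | inj₂ (s , M≡1+2s , M-odd) =
  inj₁ (suc s , trans (cong suc M≡1+2s) (cong suc (sym (ℕₚ.+-suc s s))) , cong not M-odd)

fromBool : Bool → ℚ
fromBool b = if b then 1ℚ else 0ℚ

fromBool-zeroOne : ∀ b → (fromBool b ≡ 0ℚ) ⊎ (fromBool b ≡ 1ℚ)
fromBool-zeroOne true  = inj₂ refl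
fromBool-zeroOne false = inj₁ refl

fromBool-not : ∀ b → fromBool b + fromBool (not b) ≡ 1ℚ
fromBool-not true  = refl
fromBool-not false = refl

-- The wrap-around edge M → 0 flips the parity too, since M is odd.
isEven-next : ∀ {M} → isEven M ≡ false → ∀ (p : Fin (suc M)) → isEven (toℕ (next p)) ≡ not (isEven (toℕ p))
isEven-next M-odd p with rimStep-next p
... | inj₁ next≡1+p        = cong isEven next≡1+p
... | inj₂ (1+p≡1+M , next≡0) =
  trans (cong isEven next≡0) (cong not (sym (trans (cong isEven (ℕₚ.suc-injective 1+p≡1+M)) M-odd)))

edgeSums-const⇒alternating : ∀ {M} (D : Fin (suc M) → ℚ) b → (∀ q → D q + D (next q) ≡ b) →
                             ∀ q → D q ≡ (if isEven (toℕ q) then D zero else b - D zero)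
edgeSums-const⇒alternating D b D-edge = <-weakInduction _ refl step
  where
  alternate : ∀ e → b - (if e then D zero else b - D zero) ≡ (if not e then D zero else b - D zero)
  alternate true  = refl
  alternate false = b-[b-d]≡d b (D zero)
    where b-[b-d]≡d : ∀ b d → b - (b - d) ≡ d
          b-[b-d]≡d = solve-∀ ℚ-ring
  step : ∀ k → D (inject₁ k) ≡ (if isEven (toℕ (inject₁ k)) then D zero else b - D zero) →
         D (suc k) ≡ (if isEven (toℕ (suc k)) then D zero else b - D zero)
  step k IH = begin
    D (suc k)                   ≡⟨ cong D (next-inject₁ k) ⟨
    D (next (inject₁ k))        ≡⟨ p+q≡r⇒q≡r-p (D (inject₁ k)) (D-edge (inject₁ k)) ⟩
    b - D (inject₁ k)           ≡⟨ cong (_-_ b) (trans IH (cong (λ t → if isEven t then D zero else b - D zero)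
                                                                  (Finₚ.toℕ-inject₁ k))) ⟩
    b - (if isEven (toℕ k) then D zero else b - D zero) ≡⟨ alternate (isEven (toℕ k)) ⟩
    (if isEven (toℕ (suc k)) then D zero else b - D zero) ∎
    where open ≡-Reasoning

oddCycle-edgeSums-zero⇒zero : ∀ {M} → isEven M ≡ true → (D : Fin (suc M) → ℚ) →
                              (∀ q → D q + D (next q) ≡ 0ℚ) → ∀ q → D q ≡ 0ℚ
oddCycle-edgeSums-zero⇒zero {M} M-even D D-edge q =
  trans (edgeSums-const⇒alternating D 0ℚ D-edge q) (both-zero (isEven (toℕ q)))
  where
  D-last : D (fromℕ M) ≡ D zero
  D-last = trans (edgeSums-const⇒alternating D 0ℚ D-edge (fromℕ M))
    (cong (λ e → if e then D zero else 0ℚ - D zero) (trans (cong isEven (Finₚ.toℕ-fromℕ M)) M-even))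
  D0≡0 : D zero ≡ 0ℚ
  D0≡0 = half-injective (trans (cong (_+ D zero) (sym D-last))
    (trans (cong (λ t → D (fromℕ M) + D t) (sym (next-fromℕ M))) (D-edge (fromℕ M))))
  both-zero : ∀ e → (if e then D zero else 0ℚ - D zero) ≡ 0ℚ
  both-zero true  = D0≡0
  both-zero false = cong (_-_ 0ℚ) D0≡0

module EvenLengthCycle {M} (M-odd : isEven M ≡ false) where

  alternating : Bool → Fin (suc M) → ℚ
  alternating b p = fromBool (isEven (toℕ p) xor b)

  alternating-zeroOne : ∀ b → IsZeroOne (alternating b)
  alternating-zeroOne b p = fromBool-zeroOne (isEven (toℕ p) xor b)

  alternating-edge : ∀ b p → alternating b p + alternating b (next p) ≡ 1ℚ
  alternating-edge b p = begin
    fromBool (isEven (toℕ p) xor b) + fromBool (isEven (toℕ (next p)) xor b)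
      ≡⟨ cong (λ e → fromBool (isEven (toℕ p) xor b) + fromBool (e xor b)) (isEven-next M-odd p) ⟩
    fromBool (isEven (toℕ p) xor b) + fromBool (not (isEven (toℕ p)) xor b)
      ≡⟨ cong (λ e → fromBool (isEven (toℕ p) xor b) + fromBool e) (not-distribˡ-xor (isEven (toℕ p)) b) ⟨
    fromBool (isEven (toℕ p) xor b) + fromBool (not (isEven (toℕ p) xor b))
      ≡⟨ fromBool-not (isEven (toℕ p) xor b) ⟩
    1ℚ ∎
    where open ≡-Reasoning

  sumℚ-alternating : ∀ K → K ℕ.+ K ≡ suc M → ∀ b → sumℚ (alternating b) ≡ ℕ→ℚ K
  sumℚ-alternating K K+K≡M+1 b = half-injective (begin
    sumℚ (alternating b) + sumℚ (alternating b)                 ≡⟨ sumℚ-edgeSums (alternating b) ⟨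
    sumℚ (λ p → alternating b p + alternating b (next p))       ≡⟨ sumℚ-cong (alternating-edge b) ⟩
    sumℚ {suc M} (λ _ → 1ℚ)                                     ≡⟨ sumℚ-ones (suc M) ⟩
    ℕ→ℚ (suc M)                                                 ≡⟨ cong ℕ→ℚ K+K≡M+1 ⟨
    ℕ→ℚ (K ℕ.+ K)                                               ≡⟨ ℕ→ℚ-+ K K ⟩
    ℕ→ℚ K + ℕ→ℚ K                                              ∎)
    where open ≡-Reasoning

≤ᵇ-true : ∀ {a b} → a ℕ.≤ b → (a ℕ.≤ᵇ b) ≡ true
≤ᵇ-true a≤b = Equivalence.to T-≡ (ℕₚ.≤⇒≤ᵇ a≤b)

≤ᵇ-false : ∀ {a b} → b ℕ.< a → (a ℕ.≤ᵇ b) ≡ false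
≤ᵇ-false {a} {b} b<a with a ℕ.≤ᵇ b in a≤ᵇb
... | false = refl
... | true  = ⊥-elim (ℕₚ.<⇒≱ b<a (ℕₚ.≤ᵇ⇒≤ a b (subst T (sym a≤ᵇb) tt)))

-- The 0/1 pattern on 0, 1, …, M that is 1 exactly at the indices of the parity of j up to j,
-- and at those of the other parity beyond j.
oddPattern : ℕ → ℕ → Bool
oddPattern j p = isEven p xor isEven j xor (p ℕ.≤ᵇ j)

oddPattern-self : ∀ j → oddPattern j j ≡ true
oddPattern-self j rewrite ≤ᵇ-true (ℕₚ.≤-refl {j}) = e-e-true (isEven j)
  where e-e-true : ∀ e → e xor e xor true ≡ true
        e-e-true true  = refl
        e-e-true false = refl

oddPattern-after-self : ∀ j → oddPattern j (suc j) ≡ true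
oddPattern-after-self j rewrite ≤ᵇ-false (ℕₚ.n<1+n j) = not-e-e-false (isEven j)
  where not-e-e-false : ∀ e → not e xor e xor false ≡ true
        not-e-e-false true  = refl
        not-e-e-false false = refl

oddPattern-flip : ∀ j p → (p ℕ.≤ᵇ j) ≡ (suc p ℕ.≤ᵇ j) → oddPattern j (suc p) ≡ not (oddPattern j p)
oddPattern-flip j p same rewrite same = sym (not-distribˡ-xor (isEven p) _)

oddPattern-wrap : ∀ {j M} → isEven M ≡ true → j ℕ.< M → oddPattern j 0 ≡ not (oddPattern j M)
oddPattern-wrap {j} M-even j<M rewrite M-even | ≤ᵇ-false j<M = flip (isEven j)
  where flip : ∀ f → true xor f xor true ≡ not (true xor f xor false)
        flip true  = refl
        flip false = refl

oddPattern-wrap-self : ∀ {M} → isEven M ≡ true → oddPattern M 0 ≡ true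
oddPattern-wrap-self M-even rewrite M-even = refl

module OddLengthCycle {M} (M-even : isEven M ≡ true) (K : ℕ) (K+K≡M+2 : K ℕ.+ K ≡ suc (suc M)) where

  oddCover : Fin (suc M) → Fin (suc M) → ℚ
  oddCover j p = fromBool (oddPattern (toℕ j) (toℕ p))

  oddCover-zeroOne : ∀ j → IsZeroOne (oddCover j)
  oddCover-zeroOne j p = fromBool-zeroOne (oddPattern (toℕ j) (toℕ p))

  oddCover-self : ∀ j → oddCover j j ≡ 1ℚ
  oddCover-self j = cong fromBool (oddPattern-self (toℕ j))

  private
    flips : ∀ j p → p ≢ j → oddPattern (toℕ j) (toℕ (next p)) ≡ not (oddPattern (toℕ j) (toℕ p)) →
            oddCover j p + oddCover j (next p) ≡ 1ℚ + δ j p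
    flips j p p≢j flipped = begin
      oddCover j p + oddCover j (next p)                          ≡⟨ cong (λ b → oddCover j p + fromBool b) flipped ⟩
      oddCover j p + fromBool (not (oddPattern (toℕ j) (toℕ p)))  ≡⟨ fromBool-not (oddPattern (toℕ j) (toℕ p)) ⟩
      1ℚ                                                          ≡⟨ +-identityʳ 1ℚ ⟨
      1ℚ + 0ℚ                                                     ≡⟨ cong (1ℚ +_) (δ-≢ (p≢j ∘ sym)) ⟨
      1ℚ + δ j p                                                  ∎
      where open ≡-Reasoning
    repeats : ∀ j p → p ≡ j → oddPattern (toℕ j) (toℕ (next p)) ≡ true →
              oddCover j p + oddCover j (next p) ≡ 1ℚ + δ j p
    repeats j p refl next-one =
      trans (cong₂ _+_ (oddCover-self p) (cong fromBool next-one)) (cong (1ℚ +_) (sym (δ-refl p)))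

  oddCover-edge : ∀ j p → oddCover j p + oddCover j (next p) ≡ 1ℚ + δ j p
  oddCover-edge j p with rimStep-next p
  ... | inj₁ next≡1+p with ℕₚ.<-cmp (toℕ p) (toℕ j)
  ...   | tri< p<j _ _ = flips j p (λ { refl → ℕₚ.<-irrefl refl p<j })
            (trans (cong (oddPattern (toℕ j)) next≡1+p)
              (oddPattern-flip (toℕ j) (toℕ p) (trans (≤ᵇ-true (ℕₚ.<⇒≤ p<j)) (sym (≤ᵇ-true p<j)))))
  ...   | tri> _ _ j<p = flips j p (λ { refl → ℕₚ.<-irrefl refl j<p })
            (trans (cong (oddPattern (toℕ j)) next≡1+p)
              (oddPattern-flip (toℕ j) (toℕ p) (trans (≤ᵇ-false j<p) (sym (≤ᵇ-false (ℕₚ.m<n⇒m<1+n j<p))))))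
  ...   | tri≈ _ p≡j _ = repeats j p (Finₚ.toℕ-injective p≡j)
            (trans (cong (oddPattern (toℕ j)) (trans next≡1+p (cong suc p≡j))) (oddPattern-after-self (toℕ j)))
  oddCover-edge j p | inj₂ (1+p≡1+M , next≡0) with toℕ j ℕ.≟ M
  ... | yes j≡M = repeats j p (Finₚ.toℕ-injective (trans (ℕₚ.suc-injective 1+p≡1+M) (sym j≡M)))
        (trans (cong₂ oddPattern j≡M next≡0) (oddPattern-wrap-self {M} M-even))
  ... | no j≢M  = flips j p (λ { refl → j≢M (ℕₚ.suc-injective 1+p≡1+M) })
        (trans (cong (oddPattern (toℕ j)) next≡0) (trans (oddPattern-wrap {M = M} M-even j<M)
          (cong (not ∘ oddPattern (toℕ j)) (sym (ℕₚ.suc-injective 1+p≡1+M)))))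
    where j<M : toℕ j ℕ.< M
          j<M = ℕₚ.≤∧≢⇒< (ℕₚ.≤-pred (Finₚ.toℕ<n j)) j≢M


  k+k≡m+1 : ℕ→ℚ K + ℕ→ℚ K ≡ ℕ→ℚ (suc M) + 1ℚ
  k+k≡m+1 = trans (sym (ℕ→ℚ-+ K K))
    (trans (cong ℕ→ℚ K+K≡M+2) (trans (ℕ→ℚ-suc (suc M)) (+-comm 1ℚ (ℕ→ℚ (suc M)))))

  sumℚ-oddCover : ∀ j → sumℚ (oddCover j) ≡ ℕ→ℚ K
  sumℚ-oddCover j = half-injective (begin
    sumℚ (oddCover j) + sumℚ (oddCover j)                    ≡⟨ sumℚ-edgeSums (oddCover j) ⟨
    sumℚ (λ p → oddCover j p + oddCover j (next p))          ≡⟨ sumℚ-cong (oddCover-edge j) ⟩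
    sumℚ (λ p → 1ℚ + δ j p)                                  ≡⟨ sumℚ-+ (λ _ → 1ℚ) (δ j) ⟩
    sumℚ {suc M} (λ _ → 1ℚ) + sumℚ (δ j)                     ≡⟨ cong₂ _+_ (sumℚ-ones (suc M)) (sumℚ-δ-one j) ⟩
    ℕ→ℚ (suc M) + 1ℚ                                         ≡⟨ k+k≡m+1 ⟨
    ℕ→ℚ K + ℕ→ℚ K                                            ∎)
    where open ≡-Reasoning

  -- Both sides have the same edge sums, and on an odd cycle a vector is determined by them.
  oddCover-decomposition : ∀ (c : Fin (suc M) → ℚ) q →
    c q ≡ sumℚ (λ j → (c j + c (next j) - 1ℚ) * oddCover j q) + (ℕ→ℚ K - sumℚ c)
  oddCover-decomposition c q = sym (q-p≡0⇒p≡q (oddCycle-edgeSums-zero⇒zero M-even D D-edge q))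
    where
    S = sumℚ c
    k = ℕ→ℚ K
    μ = ℕ→ℚ (suc M)
    excess : Fin (suc M) → ℚ
    excess j = c j + c (next j) - 1ℚ
    P : Fin (suc M) → ℚ
    P q = sumℚ (λ j → excess j * oddCover j q)
    P-edge : ∀ q → P q + P (next q) ≡ (S + S - μ) + excess q
    P-edge q = begin
      P q + P (next q)
        ≡⟨ sumℚ-+ (λ j → excess j * oddCover j q) (λ j → excess j * oddCover j (next q)) ⟨
      sumℚ (λ j → excess j * oddCover j q + excess j * oddCover j (next q))
        ≡⟨ sumℚ-cong (λ j → trans (sym (*-distribˡ-+ (excess j) (oddCover j q) (oddCover j (next q))))
                                  (cong (excess j *_) (oddCover-edge j q))) ⟩
      sumℚ (λ j → excess j * (1ℚ + δ j q))
        ≡⟨ sumℚ-cong (λ j → trans (a*[1+d]≡a+d*a (excess j) (δ j q)) (cong (λ t → excess j + t * excess j) (δ-sym j q))) ⟩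
      sumℚ (λ j → excess j + δ q j * excess j)
        ≡⟨ sumℚ-+ excess (λ j → δ q j * excess j) ⟩
      sumℚ excess + sumℚ (λ j → δ q j * excess j)
        ≡⟨ cong₂ _+_ (sumℚ-edgeExcesses c) (sumℚ-δ q excess) ⟩
      (S + S - μ) + excess q
        ∎
      where open ≡-Reasoning
            a*[1+d]≡a+d*a : ∀ a d → a * (1ℚ + d) ≡ a + d * a
            a*[1+d]≡a+d*a = solve-∀ ℚ-ring
    D : Fin (suc M) → ℚ
    D q = c q - (P q + (k - S))
    D-edge : ∀ q → D q + D (next q) ≡ 0ℚ
    D-edge q = begin
      D q + D (next q)
        ≡⟨ regroup (c q) (c (next q)) (P q) (P (next q)) k S ⟩
      (c q + c (next q)) - (P q + P (next q)) - (k + k) + (S + S)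
        ≡⟨ cong₂ (λ u v → c q + c (next q) - u - v + (S + S)) (P-edge q) k+k≡m+1 ⟩
      (c q + c (next q)) - ((S + S - μ) + excess q) - (μ + 1ℚ) + (S + S)
        ≡⟨ cancel (c q + c (next q)) (S + S) μ ⟩
      0ℚ ∎
      where open ≡-Reasoning
            regroup : ∀ a b p₁ p₂ k S →
                      (a - (p₁ + (k - S))) + (b - (p₂ + (k - S))) ≡ (a + b) - (p₁ + p₂) - (k + k) + (S + S)
            regroup = solve-∀ ℚ-ring
            cancel : ∀ e SS μ → e - ((SS - μ) + (e - 1ℚ)) - (μ + 1ℚ) + SS ≡ 0ℚ
            cancel = solve-∀ ℚ-ring

  sumℚ-oddCover-column : ∀ q → sumℚ (λ j → oddCover j q) ≡ ℕ→ℚ K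
  sumℚ-oddCover-column q = begin
    sumℚ (λ j → oddCover j q)                   ≡⟨ sumℚ-cong (λ j → *-identityˡ (oddCover j q)) ⟨
    sumℚ (λ j → 1ℚ * oddCover j q)              ≡⟨ p+q≡r⇒q≡r-p (ℕ→ℚ K - ℕ→ℚ (suc M)) ones-decomposed ⟩
    1ℚ - (ℕ→ℚ K - ℕ→ℚ (suc M))                  ≡⟨ 1-[k-μ]≡μ+1-k (ℕ→ℚ K) (ℕ→ℚ (suc M)) ⟩
    (ℕ→ℚ (suc M) + 1ℚ) - ℕ→ℚ K                  ≡⟨ cong (_- ℕ→ℚ K) k+k≡m+1 ⟨
    (ℕ→ℚ K + ℕ→ℚ K) - ℕ→ℚ K                     ≡⟨ p+q-p≡q (ℕ→ℚ K) (ℕ→ℚ K) ⟩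
    ℕ→ℚ K                                       ∎
    where
    open ≡-Reasoning
    ones-decomposed : (ℕ→ℚ K - ℕ→ℚ (suc M)) + sumℚ (λ j → 1ℚ * oddCover j q) ≡ 1ℚ
    ones-decomposed = sym (trans (oddCover-decomposition (λ _ → 1ℚ) q)
      (trans (cong (sumℚ (λ j → 1ℚ * oddCover j q) +_) (cong (_-_ (ℕ→ℚ K)) (sumℚ-ones (suc M))))
        (+-comm (sumℚ (λ j → 1ℚ * oddCover j q)) (ℕ→ℚ K - ℕ→ℚ (suc M)))))
    1-[k-μ]≡μ+1-k : ∀ k μ → 1ℚ - (k - μ) ≡ (μ + 1ℚ) - k
    1-[k-μ]≡μ+1-k = solve-∀ ℚ-ring

-- Wheels

pos*[1-t]≤0⇒1≤t : ∀ {a t} → 0ℚ < a → a * (1ℚ - t) ≤ 0ℚ → 1ℚ ≤ t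
pos*[1-t]≤0⇒1≤t {a} {t} a>0 a[1-t]≤0 = ≤-by-slack (0ℚ - (1ℚ - t)) (t-1≡0-[1-t] t)
  (p≤q⇒0≤q-p (*-cancelˡ-≤-pos a {{positive a>0}} (subst (a * (1ℚ - t) ≤_) (sym (*-zeroʳ a)) a[1-t]≤0)))
  where t-1≡0-[1-t] : ∀ t → t - 1ℚ ≡ 0ℚ - (1ℚ - t)
        t-1≡0-[1-t] = solve-∀ ℚ-ring

module Wheel {n} {G : Graph n} (M : ℕ) (π : Fin n ⤖ Fin (suc (suc M)))
  (iso : ∀ u v → (G u v → WheelAdj (suc M) (Bijection.to π u) (Bijection.to π v))
               × (WheelAdj (suc M) (Bijection.to π u) (Bijection.to π v) → G u v)) where

  private
    m = suc M
    to   = Bijection.to π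
    from = Inverse.from (⤖⇒↔ π)
    to-from : ∀ w → to (from w) ≡ w
    to-from = Inverse.strictlyInverseˡ (⤖⇒↔ π)
    from-to : ∀ v → from (to v) ≡ v
    from-to = Inverse.strictlyInverseʳ (⤖⇒↔ π)

  hub : Fin n
  hub = from zero

  rim : Fin m → Fin n
  rim p = from (suc p)

  adjacent : ∀ {a b} → WheelAdj m a b → G (from a) (from b)
  adjacent {a} {b} ab = proj₂ (iso (from a) (from b)) (subst₂ (WheelAdj m) (sym (to-from a)) (sym (to-from b)) ab)

  hub-rim : ∀ p → G hub (rim p)
  hub-rim p = adjacent tt

  rim-next : ∀ p → G (rim p) (rim (next p))
  rim-next p = adjacent (inj₁ (rimStep-next p))

  from-injective : ∀ {a b} → from a ≡ from b → a ≡ b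
  from-injective {a} {b} eq = trans (sym (to-from a)) (trans (cong to eq) (to-from b))

  rim-injective : ∀ {p q} → rim p ≡ rim q → p ≡ q
  rim-injective = Finₚ.suc-injective ∘ from-injective

  hub≢rim : ∀ p → hub ≢ rim p
  hub≢rim p eq with from-injective eq
  ... | ()

  sumℚ-wheel : ∀ (y : Fin n → ℚ) → sumℚ y ≡ y hub + sumℚ (y ∘ rim)
  sumℚ-wheel y = trans (sumℚ-cong (cong y ∘ sym ∘ from-to)) (sym (sumℚ-reindex π (y ∘ from)))

  withHub : (Fin m → ℚ) → Fin n → ℚ
  withHub ζ = (1ℚ ∷ᶠ ζ) ∘ to

  withHub-hub : ∀ ζ → withHub ζ hub ≡ 1ℚ
  withHub-hub ζ = cong (1ℚ ∷ᶠ ζ) (to-from zero)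

  withHub-rim : ∀ ζ p → withHub ζ (rim p) ≡ ζ p
  withHub-rim ζ p = cong (1ℚ ∷ᶠ ζ) (to-from (suc p))

  withHub-zeroOne : ∀ {ζ} → IsZeroOne ζ → IsZeroOne (withHub ζ)
  withHub-zeroOne ζ01 v with to v
  ... | zero  = inj₂ refl
  ... | suc p = ζ01 p

  withHub-covers : ∀ {ζ} → (∀ p → 0ℚ ≤ ζ p) → (∀ p → 1ℚ ≤ ζ p + ζ (next p)) → Covers G (withHub ζ)
  withHub-covers {ζ} ζ≥0 ζ-edge u v uv = covers (to u) (to v) (proj₁ (iso u v) uv)
    where
    covers : ∀ a b → WheelAdj m a b → 1ℚ ≤ (1ℚ ∷ᶠ ζ) a + (1ℚ ∷ᶠ ζ) b
    covers zero    (suc q) _ = p≤p+q (ζ≥0 q)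
    covers (suc p) zero    _ = p≤q+p (ζ≥0 p)
    covers (suc p) (suc q) (inj₁ p→q) = subst (λ r → 1ℚ ≤ ζ p + ζ r) (sym (rimStep⇒≡next p→q)) (ζ-edge p)
    covers (suc p) (suc q) (inj₂ q→p) =
      subst (λ r → 1ℚ ≤ ζ r + ζ q) (sym (rimStep⇒≡next q→p)) (subst (1ℚ ≤_) (+-comm (ζ q) (ζ (next q))) (ζ-edge q))

  sumℚ-withHub : ∀ ζ → sumℚ (withHub ζ) ≡ 1ℚ + sumℚ ζ
  sumℚ-withHub ζ = sym (sumℚ-reindex π (1ℚ ∷ᶠ ζ))

  pointwise-wheel : ∀ (x : Fin n → ℚ) (f : Fin (suc m) → ℚ) → x hub ≡ f zero → (∀ p → x (rim p) ≡ f (suc p)) →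
                    ∀ v → x v ≡ f (to v)
  pointwise-wheel x f at-hub at-rim v = trans (cong x (sym (from-to v))) (at (to v))
    where at : ∀ w → x (from w) ≡ f w
          at zero    = at-hub
          at (suc p) = at-rim p

  -- A 0/1 cover either contains the hub and covers the rim cycle, or contains the whole rim.
  wheel-cover-≥ : ∀ K → K ℕ.+ K ℕ.≤ suc m → suc K ℕ.≤ m → ∀ y → IsZeroOne y → Covers G y → 1ℚ + ℕ→ℚ K ≤ sumℚ y
  wheel-cover-≥ K 2K≤m+1 K<m y y01 y-covers with y01 hub
  ... | inj₂ y-hub≡1 = subst (1ℚ + ℕ→ℚ K ≤_) (sym (trans (sumℚ-wheel y) (cong (_+ sumℚ (y ∘ rim)) y-hub≡1)))
      (+-monoʳ-≤ 1ℚ (cyclicCover-≥ (y ∘ rim) (y01 ∘ rim) (λ p → y-covers _ _ (rim-next p)) K 2K≤m+1))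
  ... | inj₁ y-hub≡0 =
    subst (1ℚ + ℕ→ℚ K ≤_) (sym (trans (sumℚ-wheel y) (trans (cong (_+ sumℚ (y ∘ rim)) y-hub≡0) (+-identityˡ _))))
      (≤-trans (subst (_≤ ℕ→ℚ m) (ℕ→ℚ-suc K) (ℕ→ℚ-mono-≤ K<m))
        (subst (_≤ sumℚ (y ∘ rim)) (sumℚ-ones m) (sumℚ-mono-≤ rim-in-cover)))
    where
    rim-in-cover : ∀ p → 1ℚ ≤ y (rim p)
    rim-in-cover p = subst (1ℚ ≤_) (trans (cong (_+ y (rim p)) y-hub≡0) (+-identityˡ (y (rim p))))
                       (y-covers hub (rim p) (hub-rim p))

  -- An edge is recorded through the equation it induces on every vector f.
  data WheelEdge (i j : Fin n) : Set where
    spoke   : ∀ a → (∀ (f : Fin n → ℚ) → f i + f j ≡ f hub + f (rim a)) → WheelEdge i j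
    rimEdge : ∀ a → (∀ (f : Fin n → ℚ) → f i + f j ≡ f (rim a) + f (rim (next a))) → WheelEdge i j

  wheelEdge : ∀ {i j} → G i j → WheelEdge i j
  wheelEdge {i} {j} ij = classify (to i) (to j) (proj₁ (iso i j) ij) (from-to i) (from-to j)
    where
    endpoints : ∀ {a b} → from a ≡ i → from b ≡ j → ∀ (f : Fin n → ℚ) → f i + f j ≡ f (from a) + f (from b)
    endpoints refl refl f = refl
    classify : ∀ a b → WheelAdj m a b → from a ≡ i → from b ≡ j → WheelEdge i j
    classify zero    (suc q) _ a≡i b≡j = spoke q (endpoints a≡i b≡j)
    classify (suc p) zero    _ a≡i b≡j = spoke p (λ f → trans (endpoints a≡i b≡j f) (+-comm (f (rim p)) (f hub)))
    classify (suc p) (suc q) (inj₁ p→q) a≡i b≡j =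
      rimEdge p (λ f → trans (endpoints a≡i b≡j f) (cong (λ r → f (rim p) + f (rim r)) (rimStep⇒≡next p→q)))
    classify (suc p) (suc q) (inj₂ q→p) a≡i b≡j =
      rimEdge q (λ f → trans (endpoints a≡i b≡j f)
        (trans (+-comm (f (rim p)) (f (rim q))) (cong (λ r → f (rim q) + f (rim r)) (rimStep⇒≡next q→p))))

  edgeIndex : ∀ {i j} → WheelEdge i j → Fin m
  edgeIndex (spoke a _)   = a
  edgeIndex (rimEdge a _) = a

  withHub-edge : ∀ {i j} (e : WheelEdge i j) ζ → ζ (edgeIndex e) ≡ 0ℚ → ζ (next (edgeIndex e)) ≡ 1ℚ →
                 withHub ζ i + withHub ζ j ≡ 1ℚ
  withHub-edge (spoke a sum≡) ζ ζa≡0 _ =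
    trans (sum≡ (withHub ζ)) (trans (cong₂ _+_ (withHub-hub ζ) (trans (withHub-rim ζ a) ζa≡0)) (+-identityʳ 1ℚ))
  withHub-edge (rimEdge a sum≡) ζ ζa≡0 ζa'≡1 =
    trans (sum≡ (withHub ζ))
      (trans (cong₂ _+_ (trans (withHub-rim ζ a) ζa≡0) (trans (withHub-rim ζ (next a)) ζa'≡1)) (+-identityˡ 1ℚ))

  module Optimum (M≥3 : 3 ℕ.≤ M) {i j} (ij : G i j) {x : Fin n → ℚ}
                 (x-bfs : IsBasicFeasible G i j x) (x-optimal : IsOptimal G i j x) where

    1≤M : 1 ℕ.≤ M
    1≤M = ℕₚ.≤-trans (ℕ.s≤s ℕ.z≤n) M≥3

    x-feasible : RELPFeasible G i j x
    x-feasible = proj₁ x-optimal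

    edge : WheelEdge i j
    edge = wheelEdge ij

    a : Fin m
    a = edgeIndex edge

    h : ℚ
    h = x hub

    c : Fin m → ℚ
    c = x ∘ rim

    S : ℚ
    S = sumℚ c

    rim-edge : ∀ p → 1ℚ ≤ c p + c (next p)
    rim-edge p = feasible⇒covers x-feasible _ _ (rim-next p)

    rim-triangle : ∀ p → 1ℚ + 1ℚ - h ≤ c p + c (next p)
    rim-triangle p = ≤-by-slack _ (slack h (c p) (c (next p)))
      (p≤q⇒0≤q-p (feasible-triangle x-feasible (hub-rim p) (rim-next p) (adjacent tt) (hub≢rim p)
        (next-≢ 1≤M p ∘ sym ∘ rim-injective) (hub≢rim (next p))))
      where slack : ∀ t u v → u + v - (1ℚ + 1ℚ - t) ≡ t + (u + v) - (1ℚ + 1ℚ)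
            slack = solve-∀ ℚ-ring

    optimum-≤ : ∀ K ζ → IsZeroOne ζ → (∀ p → 1ℚ ≤ ζ p + ζ (next p)) → ζ a ≡ 0ℚ → ζ (next a) ≡ 1ℚ →
                sumℚ ζ ≡ ℕ→ℚ K → h + S ≤ 1ℚ + ℕ→ℚ K
    optimum-≤ K ζ ζ01 ζ-edge ζa≡0 ζa'≡1 Σζ≡K =
      subst₂ _≤_ (sumℚ-wheel x) (trans (sumℚ-withHub ζ) (cong (1ℚ +_) Σζ≡K))
        (proj₂ x-optimal (withHub ζ) (zeroOne-cover⇒feasible (withHub-zeroOne ζ01)
          (withHub-covers (zeroOne-nonNeg ζ01) ζ-edge) (withHub-edge edge ζ ζa≡0 ζa'≡1)))

    h≤1 : ∀ K → h + S ≤ 1ℚ + ℕ→ℚ K → ℕ→ℚ K ≤ S → h ≤ 1ℚ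
    h≤1 K h+S≤1+K K≤S = ≤-by-slack _ (slack h S (ℕ→ℚ K)) (+-nonNeg (p≤q⇒0≤q-p h+S≤1+K) (p≤q⇒0≤q-p K≤S))
      where slack : ∀ t s k → 1ℚ - t ≡ (1ℚ + k - (t + s)) + (s - k)
            slack = solve-∀ ℚ-ring

    S≤K : ∀ K → h + S ≤ 1ℚ + ℕ→ℚ K → 1ℚ ≤ h → S ≤ ℕ→ℚ K
    S≤K K h+S≤1+K 1≤h = ≤-by-slack _ (slack h S (ℕ→ℚ K)) (+-nonNeg (p≤q⇒0≤q-p h+S≤1+K) (p≤q⇒0≤q-p 1≤h))
      where slack : ∀ t s k → k - s ≡ (1ℚ + k - (t + s)) + (t - 1ℚ)
            slack = solve-∀ ℚ-ring

    -- A tight rim edge and its triangle with the hub force h ≥ 1.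
    1≤h-at-rimEdge : ∀ b → (∀ (f : Fin n → ℚ) → f i + f j ≡ f (rim b) + f (rim (next b))) → 1ℚ ≤ h
    1≤h-at-rimEdge b sum≡ = ≤-by-slack _ (slack h (c b) (c (next b)))
      (+-nonNeg (p≤q⇒0≤q-p (rim-triangle b)) (≤-reflexive (sym (trans (cong (_-_ 1ℚ) cb+cb'≡1) (+-inverseʳ 1ℚ)))))
      where
      cb+cb'≡1 : c b + c (next b) ≡ 1ℚ
      cb+cb'≡1 = trans (sym (sum≡ x)) (RELPFeasible.eqn x-feasible)
      slack : ∀ t u v → t - 1ℚ ≡ (u + v - (1ℚ + 1ℚ - t)) + (1ℚ - (u + v))
      slack = solve-∀ ℚ-ring

    integralMinCover : ∀ K → K ℕ.+ K ℕ.≤ suc m → suc K ℕ.≤ m → h + S ≤ 1ℚ + ℕ→ℚ K →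
                       ConvexCombinationOfCovers G x → IsIntegralMinCover G x
    integralMinCover K 2K≤m+1 K<m h+S≤1+K hull =
      zeroOne-bounded⇒integralMinCover x-feasible (basicFeasible-convexCombination⇒zeroOne ij x-bfs hull)
        (1ℚ + ℕ→ℚ K) (subst (_≤ 1ℚ + ℕ→ℚ K) (sym (sumℚ-wheel x)) h+S≤1+K) (wheel-cover-≥ K 2K≤m+1 K<m)

    module EvenRim (s : ℕ) (M≡1+2s : M ≡ suc (s ℕ.+ s)) (M-odd : isEven M ≡ false) where
      open EvenLengthCycle {M} M-odd

      K : ℕ
      K = suc s

      K+K≡m : K ℕ.+ K ≡ m
      K+K≡m = trans (cong suc (ℕₚ.+-suc s s)) (cong suc (sym M≡1+2s))

      k+k≡μ : ℕ→ℚ K + ℕ→ℚ K ≡ ℕ→ℚ m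
      k+k≡μ = trans (sym (ℕ→ℚ-+ K K)) (cong ℕ→ℚ K+K≡m)

      b : Bool
      b = isEven (toℕ a)

      ζ : Fin m → ℚ
      ζ = alternating b

      ζa≡0 : ζ a ≡ 0ℚ
      ζa≡0 = cong fromBool (xor-same (isEven (toℕ a)))

      h+S≤1+K : h + S ≤ 1ℚ + ℕ→ℚ K
      h+S≤1+K = optimum-≤ K ζ (alternating-zeroOne b) (≤-reflexive ∘ sym ∘ alternating-edge b) ζa≡0
        (trans (sym (+-identityˡ (ζ (next a)))) (trans (cong (_+ ζ (next a)) (sym ζa≡0)) (alternating-edge b a)))
        (sumℚ-alternating K K+K≡m b)

      2S≡Σedges : sumℚ (λ p → c p + c (next p)) ≡ S + S
      2S≡Σedges = sumℚ-edgeSums c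

      K≤S : ℕ→ℚ K ≤ S
      K≤S = half-cancel-≤ (subst₂ _≤_ (trans (sumℚ-ones m) (sym k+k≡μ)) 2S≡Σedges (sumℚ-mono-≤ rim-edge))

      -- Summing the rim triangles gives m (2 - h) ≤ 2S ≤ 2 (1 + K - h) = 2 + m - 2h.
      1≤h : 1ℚ ≤ h
      1≤h = pos*[1-t]≤0⇒1≤t (p<q⇒0<q-p 2<μ) (≤-by-slack _ (slack (ℕ→ℚ m) h S (ℕ→ℚ K))
        (+-nonNeg (+-nonNeg (p≤q⇒0≤q-p triangles) (+-nonNeg (p≤q⇒0≤q-p h+S≤1+K) (p≤q⇒0≤q-p h+S≤1+K)))
                  (≤-reflexive (sym (trans (cong (_-_ (ℕ→ℚ m)) k+k≡μ) (+-inverseʳ (ℕ→ℚ m)))))))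
        where
        2<μ : 1ℚ + 1ℚ < ℕ→ℚ m
        2<μ = ℕ→ℚ-mono-< (ℕ.s≤s (ℕₚ.≤-trans (ℕ.s≤s (ℕ.s≤s ℕ.z≤n)) M≥3))
        triangles : ℕ→ℚ m * (1ℚ + 1ℚ - h) ≤ S + S
        triangles = subst₂ _≤_ (sumℚ-const {m} (1ℚ + 1ℚ - h)) 2S≡Σedges (sumℚ-mono-≤ rim-triangle)
        slack : ∀ μ t s k → 0ℚ - (μ - (1ℚ + 1ℚ)) * (1ℚ - t) ≡
                ((s + s) - μ * (1ℚ + 1ℚ - t)) + ((1ℚ + k - (t + s)) + (1ℚ + k - (t + s))) + (μ - (k + k))
        slack = solve-∀ ℚ-ring

      h≡1 : h ≡ 1ℚ
      h≡1 = ≤-antisym (h≤1 K h+S≤1+K K≤S) 1≤h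

      edgeSum≡1 : ∀ p → c p + c (next p) ≡ 1ℚ
      edgeSum≡1 = sumℚ-≤-squeeze rim-edge (≤-reflexive (begin
        sumℚ (λ p → c p + c (next p))   ≡⟨ 2S≡Σedges ⟩
        S + S                            ≡⟨ cong₂ _+_ S≡K S≡K ⟩
        ℕ→ℚ K + ℕ→ℚ K                  ≡⟨ k+k≡μ ⟩
        ℕ→ℚ m                           ≡⟨ sumℚ-ones m ⟨
        sumℚ {m} (λ _ → 1ℚ)             ∎))
        where open ≡-Reasoning
              S≡K : S ≡ ℕ→ℚ K
              S≡K = ≤-antisym (S≤K K h+S≤1+K 1≤h) K≤S

      c-alternating : ∀ p → c p ≡ c zero * alternating false p + ((1ℚ - c zero) * alternating true p + 0ℚ)
      c-alternating p = trans (edgeSums-const⇒alternating c 1ℚ edgeSum≡1 p) (select (isEven (toℕ p)))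
        where
        select : ∀ e → (if e then c zero else 1ℚ - c zero) ≡
                 c zero * fromBool (e xor false) + ((1ℚ - c zero) * fromBool (e xor true) + 0ℚ)
        select true  = a≡a*1+b*0+0 (c zero) (1ℚ - c zero)
          where a≡a*1+b*0+0 : ∀ a b → a ≡ a * 1ℚ + (b * 0ℚ + 0ℚ)
                a≡a*1+b*0+0 = solve-∀ ℚ-ring
        select false = b≡a*0+b*1+0 (c zero) (1ℚ - c zero)
          where b≡a*0+b*1+0 : ∀ a b → b ≡ a * 0ℚ + (b * 1ℚ + 0ℚ)
                b≡a*0+b*1+0 = solve-∀ ℚ-ring

      hull : ConvexCombinationOfCovers G x
      hull = record
        { size          = 2
        ; weight        = λ { zero → c zero ; (suc zero) → 1ℚ - c zero }
        ; cover         = λ { zero → withHub (alternating false) ; (suc zero) → withHub (alternating true) }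
        ; weight-nonNeg = λ { zero → RELPFeasible.nonneg x-feasible (rim zero)
                            ; (suc zero) → subst (0ℚ ≤_) (p+q≡r⇒q≡r-p (c zero) (edgeSum≡1 zero))
                                             (RELPFeasible.nonneg x-feasible (rim (next zero))) }
        ; weight-sum    = trans (cong (c zero +_) (+-identityʳ (1ℚ - c zero))) (p+[q-p]≡q (c zero) 1ℚ)
        ; cover-zeroOne = λ { zero       → withHub-zeroOne (alternating-zeroOne false)
                            ; (suc zero) → withHub-zeroOne (alternating-zeroOne true) }
        ; cover-covers  = λ { zero       → alternating-covers false
                            ; (suc zero) → alternating-covers true }
        ; decomposition = pointwise-wheel x
            (λ w → c zero * (1ℚ ∷ᶠ alternating false) w + ((1ℚ - c zero) * (1ℚ ∷ᶠ alternating true) w + 0ℚ))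
            (trans h≡1 (1≡a*1+[1-a]*1+0 (c zero))) c-alternating
        }
        where
        1≡a*1+[1-a]*1+0 : ∀ a → 1ℚ ≡ a * 1ℚ + ((1ℚ - a) * 1ℚ + 0ℚ)
        1≡a*1+[1-a]*1+0 = solve-∀ ℚ-ring
        alternating-covers : ∀ b → Covers G (withHub (alternating b))
        alternating-covers b = withHub-covers (zeroOne-nonNeg (alternating-zeroOne b)) (≤-reflexive ∘ sym ∘ alternating-edge b)

      result : IsIntegralMinCover G x
      result = integralMinCover K (ℕₚ.≤-trans (ℕₚ.≤-reflexive K+K≡m) (ℕₚ.n≤1+n m))
        (ℕ.s≤s (subst (K ℕ.≤_) (sym M≡1+2s) (ℕ.s≤s (ℕₚ.m≤m+n s s)))) h+S≤1+K hull

    module OddRim (s : ℕ) (M≡2s : M ≡ s ℕ.+ s) (M-even : isEven M ≡ true) where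

      K : ℕ
      K = suc s

      K+K≡m+1 : K ℕ.+ K ≡ suc m
      K+K≡m+1 = trans (cong suc (ℕₚ.+-suc s s)) (cong (λ t → ℕ.suc (ℕ.suc t)) (sym M≡2s))

      open OddLengthCycle {M} M-even K K+K≡m+1

      2≤s : 2 ℕ.≤ s
      2≤s with ℕₚ.≤-<-connex 2 s
      ... | inj₁ 2≤s = 2≤s
      ... | inj₂ s<2 =
        ⊥-elim (ℕₚ.<⇒≱ (ℕ.s≤s (ℕₚ.+-mono-≤ (ℕₚ.≤-pred s<2) (ℕₚ.≤-pred s<2))) (subst (3 ℕ.≤_) M≡2s M≥3))

      ζ : Fin m → ℚ
      ζ = oddCover (next a)

      ζa'≡1 : ζ (next a) ≡ 1ℚ
      ζa'≡1 = oddCover-self (next a)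

      ζa≡0 : ζ a ≡ 0ℚ
      ζa≡0 = p+1≡1⇒p≡0 (trans (cong (ζ a +_) (sym ζa'≡1))
        (trans (oddCover-edge (next a) a) (trans (cong (1ℚ +_) (δ-≢ (next-≢ 1≤M a))) (+-identityʳ 1ℚ))))
        where p+1≡1⇒p≡0 : ∀ {p} → p + 1ℚ ≡ 1ℚ → p ≡ 0ℚ
              p+1≡1⇒p≡0 {p} p+1≡1 = trans (p+q≡r⇒q≡r-p 1ℚ (trans (+-comm 1ℚ p) p+1≡1)) (+-inverseʳ 1ℚ)

      h+S≤1+K : h + S ≤ 1ℚ + ℕ→ℚ K
      h+S≤1+K = optimum-≤ K ζ (oddCover-zeroOne (next a)) ζ-edge ζa≡0 ζa'≡1 (sumℚ-oddCover (next a))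
        where ζ-edge : ∀ p → 1ℚ ≤ ζ p + ζ (next p)
              ζ-edge p = subst (1ℚ ≤_) (sym (oddCover-edge (next a) p)) (p≤p+q (δ-nonNeg (next a) p))

      K≤S : ℕ→ℚ K ≤ S
      K≤S = feasible-cyclic x-feasible s (trans M≡2s (cong (s ℕ.+_) (sym (ℕₚ.+-identityʳ s))))
        (ℕₚ.≤-trans (ℕ.s≤s ℕ.z≤n) 2≤s) rim rim-injective rim-next

      excess : Fin m → ℚ
      excess p = c p + c (next p) - 1ℚ

      -- At a spoke hub–rim b, c b = 1 - h; the decomposition of c at b has every weight at least
      -- 1 - h (rim triangles) on covers whose values at b sum to K, so 1 - h ≥ (1 - h) K + K - S.
      1≤h-at-spoke : ∀ b → (∀ (f : Fin n → ℚ) → f i + f j ≡ f hub + f (rim b)) → 1ℚ ≤ h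
      1≤h-at-spoke b sum≡ = pos*[1-t]≤0⇒1≤t (p<q⇒0<q-p 2<k) (≤-by-slack _ (slack h k S P)
        (+-nonNeg (+-nonNeg (p≤q⇒0≤q-p P≥[1-h]k) (p≤q⇒0≤q-p h+S≤1+K)) (≤-reflexive (sym decomposed))))
        where
        k = ℕ→ℚ K
        cb = c b
        P = sumℚ (λ p → excess p * oddCover p b)
        2<k : 1ℚ + 1ℚ < k
        2<k = ℕ→ℚ-mono-< (ℕ.s≤s 2≤s)
        h+cb≡1 : h + cb ≡ 1ℚ
        h+cb≡1 = trans (sym (sum≡ x)) (RELPFeasible.eqn x-feasible)
        P≥[1-h]k : (1ℚ - h) * k ≤ P
        P≥[1-h]k = subst (_≤ P) (trans (sumℚ-*ˡ (1ℚ - h) (λ p → oddCover p b)) (cong ((1ℚ - h) *_) (sumℚ-oddCover-column b)))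
          (sumℚ-mono-≤ λ p → *-monoʳ-≤-nonNeg (oddCover p b) {{nonNegative (zeroOne-nonNeg (oddCover-zeroOne p) b)}}
                                               {1ℚ - h} {excess p} (excess-≥ p))
          where
          excess-≥ : ∀ p → 1ℚ - h ≤ excess p
          excess-≥ p = ≤-by-slack _ (slack h (c p) (c (next p))) (p≤q⇒0≤q-p (rim-triangle p))
            where slack : ∀ t u v → u + v - 1ℚ - (1ℚ - t) ≡ u + v - (1ℚ + 1ℚ - t)
                  slack = solve-∀ ℚ-ring
        decomposed : (1ℚ - h - k + S) - P ≡ 0ℚ
        decomposed = begin
          1ℚ - h - k + S - P               ≡⟨ cong (λ t → t - k + S - P) (p+q≡r⇒q≡r-p h h+cb≡1) ⟨
          cb - k + S - P                   ≡⟨ cong (λ t → t - k + S - P) (oddCover-decomposition c b) ⟩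
          P + (k - S) - k + S - P          ≡⟨ cancel P k S ⟩
          0ℚ                               ∎
          where open ≡-Reasoning
                cancel : ∀ P k S → P + (k - S) - k + S - P ≡ 0ℚ
                cancel = solve-∀ ℚ-ring
        slack : ∀ t k S P → 0ℚ - (k - (1ℚ + 1ℚ)) * (1ℚ - t) ≡
                (P - (1ℚ - t) * k) + ((1ℚ + k) - (t + S)) + ((1ℚ - t - k + S) - P)
        slack = solve-∀ ℚ-ring

      1≤h : 1ℚ ≤ h
      1≤h with edge
      ... | spoke b sum≡   = 1≤h-at-spoke b sum≡
      ... | rimEdge b sum≡ = 1≤h-at-rimEdge b sum≡

      h≡1 : h ≡ 1ℚ
      h≡1 = ≤-antisym (h≤1 K h+S≤1+K K≤S) 1≤h

      S≡K : S ≡ ℕ→ℚ K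
      S≡K = ≤-antisym (S≤K K h+S≤1+K 1≤h) K≤S

      sumℚ-excess : sumℚ excess ≡ 1ℚ
      sumℚ-excess = begin
        sumℚ excess                                   ≡⟨ sumℚ-edgeExcesses c ⟩
        S + S - ℕ→ℚ m                                 ≡⟨ cong (λ t → t + t - ℕ→ℚ m) S≡K ⟩
        ℕ→ℚ K + ℕ→ℚ K - ℕ→ℚ m                        ≡⟨ cong (_- ℕ→ℚ m) k+k≡m+1 ⟩
        ℕ→ℚ m + 1ℚ - ℕ→ℚ m                           ≡⟨ p+q-p≡q (ℕ→ℚ m) 1ℚ ⟩
        1ℚ                                            ∎
        where open ≡-Reasoning

      hull : ConvexCombinationOfCovers G x
      hull = record
        { size          = m
        ; weight        = excess
        ; cover         = withHub ∘ oddCover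
        ; weight-nonNeg = p≤q⇒0≤q-p ∘ rim-edge
        ; weight-sum    = sumℚ-excess
        ; cover-zeroOne = withHub-zeroOne ∘ oddCover-zeroOne
        ; cover-covers  = λ p → withHub-covers (zeroOne-nonNeg (oddCover-zeroOne p))
            (λ q → subst (1ℚ ≤_) (sym (oddCover-edge p q)) (p≤p+q (δ-nonNeg p q)))
        ; decomposition = pointwise-wheel x (λ w → sumℚ (λ p → excess p * (1ℚ ∷ᶠ oddCover p) w))
            (trans h≡1 (sym (trans (sumℚ-cong (λ p → *-identityʳ (excess p))) sumℚ-excess)))
            (λ q → trans (oddCover-decomposition c q)
              (trans (cong (sumℚ (λ p → excess p * oddCover p q) +_)
                           (trans (cong (_-_ (ℕ→ℚ K)) S≡K) (+-inverseʳ (ℕ→ℚ K))))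
                (+-identityʳ _)))
        }

      result : IsIntegralMinCover G x
      result = integralMinCover K (ℕₚ.≤-reflexive K+K≡m+1)
        (ℕ.s≤s (subst (K ℕ.≤_) (sym M≡2s) (ℕₚ.+-monoˡ-≤ s (ℕₚ.≤-trans (ℕ.s≤s ℕ.z≤n) 2≤s)))) h+S≤1+K hull

  wheel-integralMinCover : 3 ℕ.≤ M → ∀ {i j} → G i j → ∀ {x} → IsBasicFeasible G i j x → IsOptimal G i j x →
                           IsIntegralMinCover G x
  wheel-integralMinCover M≥3 ij x-bfs x-optimal with evenOrOdd M
  ... | inj₁ (s , M≡2s , M-even)  = Optimum.OddRim.result M≥3 ij x-bfs x-optimal s M≡2s M-even
  ... | inj₂ (s , M≡1+2s , M-odd) = Optimum.EvenRim.result M≥3 ij x-bfs x-optimal s M≡1+2s M-odd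

-- The wheel W₃ is K₄

rimStep-irrefl : ∀ {m} → 2 ℕ.≤ m → (p : Fin m) → ¬ RimStep p p
rimStep-irrefl 2≤m p (inj₁ p≡1+p)         = ℕₚ.1+n≢n (sym p≡1+p)
rimStep-irrefl 2≤m p (inj₂ (1+p≡m , p≡0)) = ℕₚ.<⇒≢ 2≤m (trans (cong suc (sym p≡0)) 1+p≡m)

wheelAdj-irrefl : ∀ {m} → 2 ℕ.≤ m → ∀ w → ¬ WheelAdj m w w
wheelAdj-irrefl 2≤m zero    ()
wheelAdj-irrefl 2≤m (suc p) = [ rimStep-irrefl 2≤m p , rimStep-irrefl 2≤m p ]′

wheelAdj₃-complete : ∀ a b → a ≢ b → WheelAdj 3 a b
wheelAdj₃-complete zero                   zero                   a≢b = ⊥-elim (a≢b refl)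
wheelAdj₃-complete zero                   (suc _)                _   = tt
wheelAdj₃-complete (suc _)                zero                   _   = tt
wheelAdj₃-complete (suc zero)             (suc zero)             a≢b = ⊥-elim (a≢b refl)
wheelAdj₃-complete (suc zero)             (suc (suc zero))       _   = inj₁ (inj₁ refl)
wheelAdj₃-complete (suc zero)             (suc (suc (suc zero))) _   = inj₂ (inj₂ (refl , refl))
wheelAdj₃-complete (suc (suc zero))       (suc zero)             _   = inj₂ (inj₁ refl)
wheelAdj₃-complete (suc (suc zero))       (suc (suc zero))       a≢b = ⊥-elim (a≢b refl)
wheelAdj₃-complete (suc (suc zero))       (suc (suc (suc zero))) _   = inj₁ (inj₁ refl)
wheelAdj₃-complete (suc (suc (suc zero))) (suc zero)             _   = inj₁ (inj₂ (refl , refl))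
wheelAdj₃-complete (suc (suc (suc zero))) (suc (suc zero))       _   = inj₂ (inj₁ refl)
wheelAdj₃-complete (suc (suc (suc zero))) (suc (suc (suc zero))) a≢b = ⊥-elim (a≢b refl)

wheel₃⇒complete : ∀ {n} {G : Graph n} (π : Fin n ⤖ Fin 4) →
                  (∀ u v → (G u v → WheelAdj 3 (Bijection.to π u) (Bijection.to π v))
                         × (WheelAdj 3 (Bijection.to π u) (Bijection.to π v) → G u v)) → IsComplete G
wheel₃⇒complete π iso u v =
  (λ uv u≡v → wheelAdj-irrefl (ℕ.s≤s (ℕ.s≤s ℕ.z≤n)) (to v)
                 (subst (λ w → WheelAdj 3 (to w) (to v)) u≡v (proj₁ (iso u v) uv))) ,
  (λ u≢v → proj₂ (iso u v) (wheelAdj₃-complete (to u) (to v) (u≢v ∘ Bijection.injective π)))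
  where to = Bijection.to π

-- The argument for wheels needs a rim of length at least 4.
isWheel-integralMinCover : ∀ {n} {G : Graph n} → IsWheel G → ∀ {i j} → G i j → ∀ {x} →
                           IsBasicFeasible G i j x → IsOptimal G i j x → IsIntegralMinCover G x
isWheel-integralMinCover (1 , ℕ.s≤s () , _)
isWheel-integralMinCover (2 , ℕ.s≤s (ℕ.s≤s ()) , _)
isWheel-integralMinCover (3 , _ , π , iso) = complete-integralMinCover (wheel₃⇒complete π iso)
isWheel-integralMinCover (suc (suc (suc (suc M))) , _ , π , iso) =
  Wheel.wheel-integralMinCover (suc (suc (suc M))) π iso (ℕ.s≤s (ℕ.s≤s (ℕ.s≤s ℕ.z≤n)))

theorem4 : (n : ℕ) (G : Graph n) → IsComplete G ⊎ IsWheel G →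
           (i j : Fin n) → G i j →
           (x : Fin n → ℚ) → IsBasicFeasible G i j x → IsOptimal G i j x →
           (∀ k → (x k ≡ 0ℚ) ⊎ (x k ≡ 1ℚ)) ×
           (Σ[ C ∈ Subset n ] (∀ k → (k ∈ C → x k ≡ 1ℚ) × (k ∉ C → x k ≡ 0ℚ))
                              × IsMinVertexCover G C)
theorem4 n G (inj₁ complete) i j ij x = complete-integralMinCover complete ij
theorem4 n G (inj₂ wheel)    i j ij x = isWheel-integralMinCover wheel ij
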